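{- For every $n\ge2$ and positive weights $a,b,c$, the dimer partition function of the Sierpiński graph $\Gamma_n$ with the "rotation-invariant" labeling is: - for $n$ even, $$\Phi_n(a,b,c)=2^{\frac{3^{n-2}-1}{2}}(a^3+b^3)^{\frac{3^{n-2}-1}{4}}(ac+bc)^{\frac{3^{n-1}-3}{4}}\big(a^3+b^3+3c(a+b)\big);$$ - for $n$ odd, $$\Phi_n(a,b,c)=2^{\frac{3^{n-2}-1}{2}}(a^3+b^3)^{\frac{3^{n-2}-3}{4}}(ac+bc)^{\frac{3^{n-1}-1}{4}}\big(3(a^3+b^3)+c(a+b)\big).$$
   Context: The labeled graphs $\Gamma_n$ ($n\ge2$) each have three distinguished corners, called $L$, $U$, $R$. $\Gamma_2$ has vertices $L,U,R,X,Y,Z$ and nine edges: - $L$–$X$, $U$–$Y$, $R$–$Z$, labeled $a$; - $L$–$Z$, $U$–$X$, $R$–$Y$, labeled $b$; - $X$–$Y$, $Y$–$Z$, $Z$–$X$, labeled $c$. For $n\ge3$, $\Gamma_n$ is obtained from three copies $\Gamma^{L},\Gamma^{U},\Gamma^{R}$ of the labeled graph $\Gamma_{n-1}$ by identifying: - the corner $R$ of $\Gamma^L$ with the corner $L$ of $\Gamma^R$; - the corner $U$ of $\Gamma^L$ with the corner $L$ of $\Gamma^U$; - the corner $R$ of $\Gamma^U$ with the corner $U$ of $\Gamma^R$. The corners of $\Gamma_n$ are the $L$-corner of $\Gamma^L$, the $U$-corner of $\Gamma^U$, and the $R$-corner of $\Gamma^R$. This gives the level-$n$ Sierpiński gasket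 graph with a labeling invariant under rotation by $2\pi/3$. A dimer covering of $\Gamma_n$ is a matching covering every non-corner vertex, and - for $n$ odd, covering exactly $0$ or $2$ corners; - for $n$ even, covering exactly $1$ or $3$ corners. With an edge labeled $s$ having weight $s>0$, $\Phi_n(a,b,c)$ is the sum over dimer coverings of the product of the weights.
   Formalization: The weights $a,b,c$ range over the positive rationals. -}

module Defs where

open import Data.Nat as ℕ using (ℕ; zero; suc; _≡ᵇ_)
open import Data.Bool using (Bool; true; false; _∧_; _∨_; not; if_then_else_)
open import Data.Fin using (Fin; zero; suc)
open import Data.Fin.Properties using () renaming (_≟_ to _≟F_)
open import Data.Product using (_×_; _,_; proj₁; proj₂)
open import Data.List using (List; []; _∷_; map; filter; _++_; foldr; length; concatMap; allFin)
open import Data.Rational using (ℚ; 0ℚ; 1ℚ; _+_; _*_)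
open import Data.Bool.Properties using (T?)
open import Relation.Nullary using (Dec; yes; no; does; ¬_)
open import Relation.Binary.PropositionalEquality using (_≡_; refl)
open import Relation.Binary.Definitions using (DecidableEquality)

data Label : Set where
  a b c : Label

_^ℚ_ : ℚ → ℕ → ℚ
x ^ℚ zero = 1ℚ
x ^ℚ suc k = x * (x ^ℚ k)

-- Index k encodes Γ_{k+2}.
-- Vertices of Γ_2 : Fin 6  with  0=L, 1=U, 2=R, 3=X, 4=Y, 5=Z.
-- Vertices of Γ_{k+3} : Fin 3 × (vertices of Γ_{k+2}), where the first
-- component selects the copy: 0 = Γ^L, 1 = Γ^U, 2 = Γ^R.  Identified
-- vertices are represented by a canonical representative (see `norm`).

Vtx : ℕ → Set
Vtx zero    = Fin 6
Vtx (suc k) = Fin 3 × Vtx k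

_≟V_ : ∀ {k} → DecidableEquality (Vtx k)
_≟V_ {zero} x y = x ≟F y
_≟V_ {suc k} (i , x) (j , y) with i ≟F j | _≟V_ {k} x y
... | yes refl | yes refl = yes refl
... | no i≢j   | _        = no λ { refl → i≢j refl }
... | yes _    | no x≢y   = no λ { refl → x≢y refl }

_==_ : ∀ {k} → Vtx k → Vtx k → Bool
_==_ {k} x y = does (_≟V_ {k} x y)

cL cU cR : ∀ k → Vtx k
cL zero = zero
cL (suc k) = (zero , cL k)
cU zero = suc zero
cU (suc k) = (suc zero , cU k)
cR zero = suc (suc zero)
cR (suc k) = (suc (suc zero) , cR k)

Edge : ℕ → Set
Edge k = Vtx k × Vtx k × Label

-- identification map for the gluing step:
--   R of Γ^L ~ L of Γ^R,  U of Γ^L ~ L of Γ^U,  R of Γ^U ~ U of Γ^R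
-- the representative kept is the one in the first-named copy.
norm : ∀ k → Fin 3 × Vtx k → Vtx (suc k)
norm k (suc (suc zero) , v) =
  if _==_ {k} v (cL k) then (zero , cR k)
  else if _==_ {k} v (cU k) then (suc zero , cR k)
  else (suc (suc zero) , v)
norm k (suc zero , v) =
  if _==_ {k} v (cL k) then (zero , cU k) else (suc zero , v)
norm k (zero , v) = (zero , v)

vertices : ∀ k → List (Vtx k)
vertices zero = allFin 6
vertices (suc k) =
  filter (λ x → _≟V_ {suc k} (norm k x) x)
    (concatMap (λ i → map (λ v → (i , v)) (vertices k)) (allFin 3))

edges : ∀ k → List (Edge k)
edges zero =
  (v0 , vX , a) ∷ (v1 , vY , a) ∷ (v2 , vZ , a) ∷
  (v0 , vZ , b) ∷ (v1 , vX , b) ∷ (v2 , vY , b) ∷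
  (vX , vY , c) ∷ (vY , vZ , c) ∷ (vZ , vX , c) ∷ []
  where
  v0 v1 v2 vX vY vZ : Fin 6
  v0 = zero
  v1 = suc zero
  v2 = suc (suc zero)
  vX = suc (suc (suc zero))
  vY = suc (suc (suc (suc zero)))
  vZ = suc (suc (suc (suc (suc zero))))
edges (suc k) =
  concatMap (λ i → map (λ { (u , v , l) → (norm k (i , u) , norm k (i , v) , l) }) (edges k))
            (allFin 3)

subsets : ∀ {A : Set} → List A → List (List A)
subsets [] = [] ∷ []
subsets (x ∷ xs) = let s = subsets xs in s ++ map (x ∷_) s

allL : ∀ {A : Set} → (A → Bool) → List A → Bool
allL p [] = true
allL p (x ∷ xs) = p x ∧ allL p xs

deg : ∀ k → List (Edge k) → Vtx k → ℕ
deg k M v = length (filter (λ e → T? (_==_ {k} v (proj₁ e) ∨ _==_ {k} v (proj₁ (proj₂ e)))) M)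

isCorner : ∀ k → Vtx k → Bool
isCorner k v = _==_ {k} v (cL k) ∨ _==_ {k} v (cU k) ∨ _==_ {k} v (cR k)

coveredCorners : ∀ k → List (Edge k) → ℕ
coveredCorners k M = length (filter (λ v → T? (deg k M v ≡ᵇ 1)) (cL k ∷ cU k ∷ cR k ∷ []))

isDimer : ∀ k → List (Edge k) → Bool
isDimer k M =
  allL (λ v → deg k M v ℕ.≤ᵇ 1) (vertices k) ∧
  allL (λ v → isCorner k v ∨ (deg k M v ≡ᵇ 1)) (vertices k) ∧
  cornerOK
  where
  m = coveredCorners k M
  cornerOK : Bool
  cornerOK = if (k ℕ.% 2) ≡ᵇ 1
             then ((m ≡ᵇ 0) ∨ (m ≡ᵇ 2))     -- n = k+2 odd
             else ((m ≡ᵇ 1) ∨ (m ≡ᵇ 3))     -- n = k+2 even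

weight : ℚ → ℚ → ℚ → Label → ℚ
weight x y z a = x
weight x y z b = y
weight x y z c = z

Φ′ : ℕ → ℚ → ℚ → ℚ → ℚ
Φ′ k x y z =
  foldr _+_ 0ℚ
    (map (λ M → foldr (λ e r → weight x y z (proj₂ (proj₂ e)) * r) 1ℚ M)
         (filter (λ M → T? (isDimer k M)) (subsets (edges k))))

Φ : ℕ → ℚ → ℚ → ℚ → ℚ
Φ n = Φ′ (n ℕ.∸ 2)

2ℚ 3ℚ : ℚ
2ℚ = 1ℚ + 1ℚ
3ℚ = 2ℚ + 1ℚ

infixr 8 _^ℚ_

-- Refine the partition function by the set t ∈ Bool³ of covered corners: Z k t is the
-- weighted count of matchings of Γ_{k+2} that cover every non-corner vertex and exactly
-- the corners in t.  Such a matching of the glued graph restricts to such matchings of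
-- the three copies, and each of the three junction vertices is covered from exactly one
-- of the two copies meeting there; summing over these three choices gives a cubic
-- recursion for Z.  By enumeration on Γ₂ and induction, Z k t is P k or Q k when the
-- number of covered corners is 3 or 1 (k even), resp. 2 or 0 (k odd), and 0 otherwise,
-- where P and Q satisfy a monomial recursion whose solution is 2^α (x³+y³)^β (xz+yz)^γ
-- times x³+y³ and xz+yz respectively.  Summing over the admissible corner sets, Φ is
-- P + 3Q or 3P + Q according to the parity of n.

module Submission where

open import Defs
open import Data.Nat using (ℕ; _≤_; _∸_; _%_; _/_)
open import Data.Nat using () renaming (_^_ to _^ℕ_)
open import Data.Rational using (ℚ; Positive; _+_; _*_)
open import Data.Integer using (+_)
open import Data.Product using (_×_)
open import Relation.Binary.PropositionalEquality using (_≡_)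

import Data.Nat as ℕ
import Data.Nat.Properties as ℕₚ
open import Data.Nat using (zero; suc; _≡ᵇ_; _≤ᵇ_; s≤s; z≤n)
open import Data.Nat.DivMod using ([m+n]%n≡m%n; m*n/n≡m)
open import Data.Nat.Tactic.RingSolver using (solve-∀)
open import Data.Bool using (Bool; true; false; _∧_; _∨_; not; _xor_; if_then_else_; T)
import Data.Bool.Properties as Bool
open import Data.Bool.Properties using (T?; ⇔→≡)
open import Data.Empty using (⊥-elim)
open import Data.Fin using (Fin; zero; suc)
open import Data.Fin.Properties using () renaming (_≟_ to _≟F_)
open import Data.List using (List; []; _∷_; map; filter; _++_; foldr; length; concatMap; allFin)
open import Data.List.Properties using (filter-++; length-++; ++-identityʳ)
open import Data.List.Membership.Propositional using (_∈_)
open import Data.List.Membership.Propositional.Properties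
  using (∈-filter⁺; ∈-filter⁻; ∈-map⁺; ∈-map⁻; ∈-concatMap⁺; ∈-concatMap⁻)
open import Data.List.Relation.Unary.Any using (Any; here; there)
open import Data.Maybe using (Maybe; just; nothing)
open import Data.Product using (_,_; proj₁; proj₂; ∃-syntax)
open import Data.Product.Properties using (≡-dec)
open import Data.Rational using (0ℚ; 1ℚ)
open import Data.Rational.Properties
  using (+-identityˡ; +-identityʳ; +-assoc; *-identityˡ; *-assoc; *-comm; *-zeroˡ; *-zeroʳ; *-distribˡ-+)
open import Data.Rational.Solver using (module +-*-Solver)
open +-*-Solver using (solve; _:=_; _:+_; _:*_; con; Polynomial)
open import Function using (_∘_)
open import Function.Bundles using (mk⇔; Equivalence)
open import Relation.Binary.Definitions using (DecidableEquality)
open import Relation.Binary.PropositionalEquality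
  using (refl; sym; trans; cong; cong₂; subst; subst₂; _≢_; module ≡-Reasoning)
open import Relation.Nullary using (yes; no; does; isYes)
open import Relation.Nullary.Decidable using (toWitness)

private
  variable
    A B : Set

∧-true : ∀ {p q} → p ≡ true → q ≡ true → (p ∧ q) ≡ true
∧-true refl refl = refl

∧-trueˡ : ∀ p {q} → (p ∧ q) ≡ true → p ≡ true
∧-trueˡ true  _ = refl

∧-trueʳ : ∀ p {q} → (p ∧ q) ≡ true → q ≡ true
∧-trueʳ true h = h

∧-regroup : ∀ i₀ i₁ i₂ e₀ e₁ e₂ σ κ τ → (e₀ ∧ (e₁ ∧ e₂)) ≡ (σ ∧ (κ ∧ τ)) →
            ((i₀ ∧ e₀) ∧ ((i₁ ∧ e₁) ∧ (i₂ ∧ e₂))) ≡ (σ ∧ ((i₀ ∧ (i₁ ∧ (i₂ ∧ κ))) ∧ τ))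
∧-regroup false i₁    i₂    e₀ e₁ e₂ σ κ τ eq = sym (Bool.∧-zeroʳ σ)
∧-regroup true  false i₂    e₀ e₁ e₂ σ κ τ eq = trans (Bool.∧-zeroʳ e₀) (sym (Bool.∧-zeroʳ σ))
∧-regroup true  true  false e₀ e₁ e₂ σ κ τ eq =
  trans (cong (e₀ ∧_) (Bool.∧-zeroʳ e₁)) (trans (Bool.∧-zeroʳ e₀) (sym (Bool.∧-zeroʳ σ)))
∧-regroup true  true  true  e₀ e₁ e₂ σ κ τ eq = eq

filter-T?-∷ : (f : A → Bool) (x : A) (xs : List A) →
  filter (λ v → T? (f v)) (x ∷ xs) ≡
  (if f x then x ∷ filter (λ v → T? (f v)) xs else filter (λ v → T? (f v)) xs)
filter-T?-∷ f x xs with f x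
... | true  = refl
... | false = refl

allL⇒∈ : (P : A → Bool) (xs : List A) → allL P xs ≡ true → ∀ v → v ∈ xs → P v ≡ true
allL⇒∈ P (x ∷ xs) h v (here refl) = ∧-trueˡ (P x) h
allL⇒∈ P (x ∷ xs) h v (there v∈xs) = allL⇒∈ P xs (∧-trueʳ (P x) h) v v∈xs

∈⇒allL : (P : A → Bool) (xs : List A) → (∀ v → v ∈ xs → P v ≡ true) → allL P xs ≡ true
∈⇒allL P []       h = refl
∈⇒allL P (x ∷ xs) h = ∧-true (h x (here refl)) (∈⇒allL P xs (λ v v∈xs → h v (there v∈xs)))

count : (A → Bool) → List A → ℕ
count f xs = length (filter (λ v → T? (f v)) xs)

count-++ : (f : A → Bool) (xs ys : List A) → count f (xs ++ ys) ≡ count f xs ℕ.+ count f ys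
count-++ f xs ys = trans (cong length (filter-++ (λ v → T? (f v)) xs ys)) (length-++ (filter (λ v → T? (f v)) xs))

count-map : (f : B → Bool) (g : A → Bool) (h : A → B) → (∀ e → f (h e) ≡ g e) →
            (xs : List A) → count f (map h xs) ≡ count g xs
count-map f g h fh≗g []       = refl
count-map f g h fh≗g (x ∷ xs)
  rewrite filter-T?-∷ f (h x) (map h xs) | filter-T?-∷ g x xs | fh≗g x with g x
... | true  = cong suc (count-map f g h fh≗g xs)
... | false = count-map f g h fh≗g xs

count-false : (xs : List A) → count (λ _ → false) xs ≡ 0
count-false []       = refl
count-false (x ∷ xs) = count-false xs

allOf : (A → Bool) → List A → Bool
allOf f = foldr (λ x r → f x ∧ r) true

allOf⇒ : (f : A → Bool) (xs : List A) → T (allOf f xs) → ∀ {x} → x ∈ xs → T (f x)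
allOf⇒ f (x ∷ xs) h (here refl)  = proj₁ (Equivalence.to (Bool.T-∧ {f x}) h)
allOf⇒ f (x ∷ xs) h (there x∈xs) = allOf⇒ f xs (proj₂ (Equivalence.to (Bool.T-∧ {f x}) h)) x∈xs

sumWith : {C : Set} → (C → C → C) → C → List A → (A → C) → C
sumWith _⊕_ 0c []       f = 0c
sumWith _⊕_ 0c (x ∷ xs) f = f x ⊕ sumWith _⊕_ 0c xs f

∑ : List A → (A → ℚ) → ℚ
∑ = sumWith _+_ 0ℚ

infixr 6 ∑
syntax ∑ xs (λ x → e) = ∑[ x ← xs ] e

[_]·_ : Bool → ℚ → ℚ
[ true  ]· q = q
[ false ]· q = 0ℚ

infixr 8 [_]·_

∑-cong : (xs : List A) {f g : A → ℚ} → (∀ x → f x ≡ g x) → ∑ xs f ≡ ∑ xs g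
∑-cong []       f≗g = refl
∑-cong (x ∷ xs) f≗g = cong₂ _+_ (f≗g x) (∑-cong xs f≗g)

∑-++ : (xs ys : List A) (f : A → ℚ) → ∑ (xs ++ ys) f ≡ ∑ xs f + ∑ ys f
∑-++ []       ys f = sym (+-identityˡ _)
∑-++ (x ∷ xs) ys f = trans (cong (_+_ (f x)) (∑-++ xs ys f)) (sym (+-assoc (f x) _ _))

∑-map : (h : B → A) (xs : List B) (f : A → ℚ) → ∑ (map h xs) f ≡ ∑[ x ← xs ] f (h x)
∑-map h []       f = refl
∑-map h (x ∷ xs) f = cong (_+_ (f (h x))) (∑-map h xs f)

foldr-+-map : (f : A → ℚ) (xs : List A) → foldr _+_ 0ℚ (map f xs) ≡ ∑ xs f
foldr-+-map f []       = refl
foldr-+-map f (x ∷ xs) = cong (_+_ (f x)) (foldr-+-map f xs)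

∑-filter : (p : A → Bool) (xs : List A) (f : A → ℚ) →
           ∑ (filter (λ x → T? (p x)) xs) f ≡ ∑[ x ← xs ] [ p x ]· f x
∑-filter p []       f = refl
∑-filter p (x ∷ xs) f rewrite filter-T?-∷ p x xs with p x
... | true  = cong (_+_ (f x)) (∑-filter p xs f)
... | false = trans (∑-filter p xs f) (sym (+-identityˡ _))

∑-zero : (xs : List A) → ∑[ x ← xs ] 0ℚ ≡ 0ℚ
∑-zero []       = refl
∑-zero (x ∷ xs) = trans (+-identityˡ _) (∑-zero xs)

∑-distrib-+ : (xs : List A) (f g : A → ℚ) → ∑[ x ← xs ] (f x + g x) ≡ ∑ xs f + ∑ xs g
∑-distrib-+ []       f g = sym (+-identityˡ _)
∑-distrib-+ (x ∷ xs) f g =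
  trans (cong (_+_ (f x + g x)) (∑-distrib-+ xs f g)) (+-interchange (f x) (g x) (∑ xs f) (∑ xs g))
  where
  +-interchange : ∀ a b c d → (a + b) + (c + d) ≡ (a + c) + (b + d)
  +-interchange = solve 4 (λ a b c d → (a :+ b) :+ (c :+ d) := (a :+ c) :+ (b :+ d)) refl

*-distribˡ-∑ : (κ : ℚ) (xs : List A) (f : A → ℚ) → κ * ∑ xs f ≡ ∑[ x ← xs ] κ * f x
*-distribˡ-∑ κ []       f = *-zeroʳ κ
*-distribˡ-∑ κ (x ∷ xs) f = trans (*-distribˡ-+ κ (f x) _) (cong (_+_ (κ * f x)) (*-distribˡ-∑ κ xs f))

*-distribʳ-∑ : (κ : ℚ) (xs : List A) (f : A → ℚ) → ∑ xs f * κ ≡ ∑[ x ← xs ] f x * κ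
*-distribʳ-∑ κ xs f =
  trans (*-comm (∑ xs f) κ) (trans (*-distribˡ-∑ κ xs f) (∑-cong xs (λ x → *-comm κ (f x))))

∑-comm : (xs : List A) (ys : List B) (f : A → B → ℚ) →
         ∑[ x ← xs ] ∑[ y ← ys ] f x y ≡ ∑[ y ← ys ] ∑[ x ← xs ] f x y
∑-comm []       ys f = sym (∑-zero ys)
∑-comm (x ∷ xs) ys f =
  trans (cong (_+_ (∑ ys (f x))) (∑-comm xs ys f)) (sym (∑-distrib-+ ys (f x) (λ y → ∑[ x ← xs ] f x y)))

∑-[]· : (p : Bool) (xs : List A) (f : A → ℚ) → ∑[ x ← xs ] [ p ]· f x ≡ [ p ]· ∑ xs f
∑-[]· true  xs f = refl
∑-[]· false xs f = ∑-zero xs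

∑*∑ : (xs : List A) (ys : List B) (f : A → ℚ) (g : B → ℚ) →
      ∑ xs f * ∑ ys g ≡ ∑[ x ← xs ] ∑[ y ← ys ] f x * g y
∑*∑ xs ys f g = trans (*-distribʳ-∑ (∑ ys g) xs f) (∑-cong xs (λ x → *-distribˡ-∑ (f x) ys g))

[]·-∧ : ∀ p q r → [ p ∧ q ]· r ≡ [ p ]· [ q ]· r
[]·-∧ true  q r = refl
[]·-∧ false q r = refl

[]·-*-[]· : ∀ p q u v → [ p ]· u * [ q ]· v ≡ [ p ∧ q ]· (u * v)
[]·-*-[]· false q     u v = *-zeroˡ ([ q ]· v)
[]·-*-[]· true  false u v = *-zeroʳ u
[]·-*-[]· true  true  u v = refl

[]·-comm : ∀ p q r → [ p ]· [ q ]· r ≡ [ q ]· [ p ]· r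
[]·-comm true  q     r = refl
[]·-comm false true  r = refl
[]·-comm false false r = refl

∑-subsets-++ : (xs ys : List A) (F : List A → ℚ) →
               ∑ (subsets (xs ++ ys)) F ≡ ∑[ S ← subsets xs ] ∑[ T ← subsets ys ] F (S ++ T)
∑-subsets-++ []       ys F = sym (+-identityʳ _)
∑-subsets-++ {A} (x ∷ xs) ys F = begin
  ∑ (subsets (xs ++ ys) ++ map (x ∷_) (subsets (xs ++ ys))) F
    ≡⟨ ∑-++ (subsets (xs ++ ys)) _ F ⟩
  ∑ (subsets (xs ++ ys)) F + ∑ (map (x ∷_) (subsets (xs ++ ys))) F
    ≡⟨ cong₂ _+_ (∑-subsets-++ xs ys F)
                 (trans (∑-map (x ∷_) (subsets (xs ++ ys)) F) (∑-subsets-++ xs ys (F ∘ (x ∷_)))) ⟩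
  ∑ (subsets xs) G + (∑[ S ← subsets xs ] ∑[ T ← subsets ys ] F (x ∷ S ++ T))
    ≡⟨ cong (_+_ (∑ (subsets xs) G)) (sym (∑-map (x ∷_) (subsets xs) G)) ⟩
  ∑ (subsets xs) G + ∑ (map (x ∷_) (subsets xs)) G
    ≡⟨ sym (∑-++ (subsets xs) _ G) ⟩
  ∑[ S ← subsets (x ∷ xs) ] ∑[ T ← subsets ys ] F (S ++ T)
    ∎
  where
  open ≡-Reasoning
  G : List A → ℚ
  G S = ∑[ T ← subsets ys ] F (S ++ T)

∑-subsets-map : (h : A → B) (xs : List A) (F : List B → ℚ) →
                ∑ (subsets (map h xs)) F ≡ ∑[ S ← subsets xs ] F (map h S)
∑-subsets-map h []       F = refl
∑-subsets-map h (x ∷ xs) F = begin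
  ∑ (subsets (map h xs) ++ map (h x ∷_) (subsets (map h xs))) F
    ≡⟨ ∑-++ (subsets (map h xs)) _ F ⟩
  ∑ (subsets (map h xs)) F + ∑ (map (h x ∷_) (subsets (map h xs))) F
    ≡⟨ cong₂ _+_ (∑-subsets-map h xs F)
                 (trans (∑-map (h x ∷_) (subsets (map h xs)) F) (∑-subsets-map h xs (F ∘ (h x ∷_)))) ⟩
  (∑[ S ← subsets xs ] F (map h S)) + (∑[ S ← subsets xs ] F (h x ∷ map h S))
    ≡⟨ cong (_+_ (∑[ S ← subsets xs ] F (map h S))) (sym (∑-map (x ∷_) (subsets xs) _)) ⟩
  ∑ (subsets xs) (F ∘ map h) + ∑ (map (x ∷_) (subsets xs)) (F ∘ map h)
    ≡⟨ sym (∑-++ (subsets xs) _ _) ⟩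
  ∑[ S ← subsets (x ∷ xs) ] F (map h S)
    ∎
  where open ≡-Reasoning

∑³-factor : (xs ys ws : List A) (ss : List B) (f g h : B → A → ℚ) →
  (∑[ x ← xs ] ∑[ y ← ys ] ∑[ w ← ws ] ∑[ s ← ss ] f s x * (g s y * h s w)) ≡
  ∑[ s ← ss ] ∑ xs (f s) * (∑ ys (g s) * ∑ ws (h s))
∑³-factor {A} {B} xs ys ws ss f g h = begin
  (∑[ x ← xs ] ∑[ y ← ys ] ∑[ w ← ws ] ∑[ s ← ss ] term s x y w)
    ≡⟨ ∑-cong xs (λ x → ∑-cong ys (λ y → ∑-comm ws ss (term' x y))) ⟩
  (∑[ x ← xs ] ∑[ y ← ys ] ∑[ s ← ss ] ∑[ w ← ws ] term s x y w)
    ≡⟨ ∑-cong xs (λ x → ∑-comm ys ss (λ y s → ∑[ w ← ws ] term s x y w)) ⟩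
  (∑[ x ← xs ] ∑[ s ← ss ] ∑[ y ← ys ] ∑[ w ← ws ] term s x y w)
    ≡⟨ ∑-comm xs ss (λ x s → ∑[ y ← ys ] ∑[ w ← ws ] term s x y w) ⟩
  (∑[ s ← ss ] ∑[ x ← xs ] ∑[ y ← ys ] ∑[ w ← ws ] term s x y w)
    ≡⟨ ∑-cong ss (λ s → sym (factor s)) ⟩
  (∑[ s ← ss ] ∑ xs (f s) * (∑ ys (g s) * ∑ ws (h s)))
    ∎
  where
  open ≡-Reasoning
  term : B → A → A → A → ℚ
  term s x y w = f s x * (g s y * h s w)
  term' : A → A → A → B → ℚ
  term' x y w s = term s x y w
  factor : ∀ s → ∑ xs (f s) * (∑ ys (g s) * ∑ ws (h s)) ≡ ∑[ x ← xs ] ∑[ y ← ys ] ∑[ w ← ws ] term s x y w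
  factor s = begin
    ∑ xs (f s) * (∑ ys (g s) * ∑ ws (h s))
      ≡⟨ cong (∑ xs (f s) *_) (∑*∑ ys ws (g s) (h s)) ⟩
    ∑ xs (f s) * (∑[ y ← ys ] ∑[ w ← ws ] g s y * h s w)
      ≡⟨ ∑*∑ xs ys (f s) (λ y → ∑[ w ← ws ] g s y * h s w) ⟩
    (∑[ x ← xs ] ∑[ y ← ys ] f s x * (∑[ w ← ws ] g s y * h s w))
      ≡⟨ ∑-cong xs (λ x → ∑-cong ys (λ y → *-distribˡ-∑ (f s x) ws (λ w → g s y * h s w))) ⟩
    (∑[ x ← xs ] ∑[ y ← ys ] ∑[ w ← ws ] term s x y w)
      ∎

module _ (k : ℕ) where

  ==-refl : (v : Vtx k) → _==_ {k} v v ≡ true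
  ==-refl v with _≟V_ {k} v v
  ... | yes _  = refl
  ... | no v≢v = ⊥-elim (v≢v refl)

  ≢⇒==-false : {u v : Vtx k} → u ≢ v → _==_ {k} u v ≡ false
  ≢⇒==-false {u} {v} u≢v with _≟V_ {k} u v
  ... | yes u≡v = ⊥-elim (u≢v u≡v)
  ... | no _    = refl

  ==⇒≡ : {u v : Vtx k} → _==_ {k} u v ≡ true → u ≡ v
  ==⇒≡ {u} {v} h with _≟V_ {k} u v
  ... | yes u≡v = u≡v
  ==⇒≡ () | no _

  ==-pair : (i j : Fin 3) (v w : Vtx k) → _==_ {suc k} (i , v) (j , w) ≡ (does (i ≟F j) ∧ _==_ {k} v w)
  ==-pair i j v w with i ≟F j | _≟V_ {k} v w
  ... | yes refl | yes refl = refl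
  ... | yes refl | no _     = refl
  ... | no _     | _        = refl

cL≢cU : ∀ k → cL k ≢ cU k
cL≢cU zero    ()
cL≢cU (suc k) ()

cL≢cR : ∀ k → cL k ≢ cR k
cL≢cR zero    ()
cL≢cR (suc k) ()

cU≢cR : ∀ k → cU k ≢ cR k
cU≢cR zero    ()
cU≢cR (suc k) ()

copyL copyU copyR : Fin 3
copyL = zero
copyU = suc zero
copyR = suc (suc zero)

module _ (k : ℕ) where

  norm-copyU-cL : norm k (copyU , cL k) ≡ (copyL , cU k)
  norm-copyU-cL rewrite ==-refl k (cL k) = refl

  norm-copyR-cL : norm k (copyR , cL k) ≡ (copyL , cR k)
  norm-copyR-cL rewrite ==-refl k (cL k) = refl

  norm-copyR-cU : norm k (copyR , cU k) ≡ (copyU , cR k)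
  norm-copyR-cU rewrite ≢⇒==-false k (cL≢cU k ∘ sym) | ==-refl k (cU k) = refl

  norm-copyU-cU : norm k (copyU , cU k) ≡ (copyU , cU k)
  norm-copyU-cU rewrite ≢⇒==-false k (cL≢cU k ∘ sym) = refl

  norm-copyU-cR : norm k (copyU , cR k) ≡ (copyU , cR k)
  norm-copyU-cR rewrite ≢⇒==-false k (cL≢cR k ∘ sym) = refl

  norm-copyR-cR : norm k (copyR , cR k) ≡ (copyR , cR k)
  norm-copyR-cR rewrite ≢⇒==-false k (cL≢cR k ∘ sym) | ≢⇒==-false k (cU≢cR k ∘ sym) = refl

  norm-idem : ∀ i v → norm k (norm k (i , v)) ≡ norm k (i , v)
  norm-idem zero v = refl
  norm-idem (suc zero) v with _≟V_ {k} v (cL k)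
  ... | yes _   = refl
  ... | no v≢cL rewrite ≢⇒==-false k v≢cL = refl
  norm-idem (suc (suc zero)) v with _≟V_ {k} v (cL k) | _≟V_ {k} v (cU k)
  ... | yes _   | _       = refl
  ... | no _    | yes _   rewrite ≢⇒==-false k (cL≢cR k ∘ sym) = refl
  ... | no v≢cL | no v≢cU rewrite ≢⇒==-false k v≢cL | ≢⇒==-false k v≢cU = refl

copies : ∀ k → List (Fin 3 × Vtx k)
copies k = concatMap (λ i → map (i ,_) (vertices k)) (allFin 3)

module _ (k : ℕ) where

  ∈-copies : ∀ i {w} → w ∈ vertices k → (i , w) ∈ copies k
  ∈-copies i w∈ = ∈-concatMap⁺ (λ j → map (j ,_) (vertices k)) {xs = allFin 3} (at i)
    where
    at : ∀ i → Any (λ j → (i , _) ∈ map (j ,_) (vertices k)) (allFin 3)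
    at zero             = here (∈-map⁺ _ w∈)
    at (suc zero)       = there (here (∈-map⁺ _ w∈))
    at (suc (suc zero)) = there (there (here (∈-map⁺ _ w∈)))

cL∈vertices : ∀ k → cL k ∈ vertices k
cU∈vertices : ∀ k → cU k ∈ vertices k
cR∈vertices : ∀ k → cR k ∈ vertices k
cL∈vertices zero    = here refl
cL∈vertices (suc k) = ∈-filter⁺ _ (∈-copies k copyL (cL∈vertices k)) refl
cU∈vertices zero    = there (here refl)
cU∈vertices (suc k) = ∈-filter⁺ _ (∈-copies k copyU (cU∈vertices k)) (norm-copyU-cU k)
cR∈vertices zero    = there (there (here refl))
cR∈vertices (suc k) = ∈-filter⁺ _ (∈-copies k copyR (cR∈vertices k)) (norm-copyR-cR k)

module _ (k : ℕ) where

  norm-∈-copies : ∀ i {v} → v ∈ vertices k → norm k (i , v) ∈ copies k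
  norm-∈-copies zero v∈ = ∈-copies k copyL v∈
  norm-∈-copies (suc zero) {v} v∈ with _≟V_ {k} v (cL k)
  ... | yes _ = ∈-copies k copyL (cU∈vertices k)
  ... | no _  = ∈-copies k copyU v∈
  norm-∈-copies (suc (suc zero)) {v} v∈ with _≟V_ {k} v (cL k) | _≟V_ {k} v (cU k)
  ... | yes _ | _     = ∈-copies k copyL (cR∈vertices k)
  ... | no _  | yes _ = ∈-copies k copyU (cR∈vertices k)
  ... | no _  | no _  = ∈-copies k copyR v∈

  vertices-suc⁻ : ∀ {p} → p ∈ vertices (suc k) →
                  ∃[ i ] ∃[ w ] w ∈ vertices k × norm k (i , w) ≡ p
  vertices-suc⁻ p∈ with ∈-filter⁻ (λ x → _≟V_ {suc k} (norm k x) x) {xs = copies k} p∈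
  ... | p∈copies , p-normal with ∈-concatMap⁻ (λ j → map (j ,_) (vertices k)) {xs = allFin 3} p∈copies
  ... | here p∈copy with ∈-map⁻ (copyL ,_) p∈copy
  ...   | w , w∈ , refl = copyL , w , w∈ , p-normal
  vertices-suc⁻ p∈ | p∈copies , p-normal | there (here p∈copy) with ∈-map⁻ (copyU ,_) p∈copy
  ...   | w , w∈ , refl = copyU , w , w∈ , p-normal
  vertices-suc⁻ p∈ | p∈copies , p-normal | there (there (here p∈copy)) with ∈-map⁻ (copyR ,_) p∈copy
  ...   | w , w∈ , refl = copyR , w , w∈ , p-normal

norm-∈-vertices : ∀ k i {v} → v ∈ vertices k → norm k (i , v) ∈ vertices (suc k)
norm-∈-vertices k i v∈ =
  ∈-filter⁺ _ (norm-∈-copies k i v∈) (norm-idem k i _)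

preimage : ∀ k → Fin 3 → Vtx (suc k) → Maybe (Vtx k)
preimage k zero             (zero , w)             = just w
preimage k zero             (suc _ , w)            = nothing
preimage k (suc zero)       (zero , w)             = if _==_ {k} w (cU k) then just (cL k) else nothing
preimage k (suc zero)       (suc zero , w)         = if _==_ {k} w (cL k) then nothing else just w
preimage k (suc zero)       (suc (suc zero) , w)   = nothing
preimage k (suc (suc zero)) (zero , w)             = if _==_ {k} w (cR k) then just (cL k) else nothing
preimage k (suc (suc zero)) (suc zero , w)         = if _==_ {k} w (cR k) then just (cU k) else nothing
preimage k (suc (suc zero)) (suc (suc zero) , w)   =
  if _==_ {k} w (cL k) ∨ _==_ {k} w (cU k) then nothing else just w

module _ (k : ℕ) where

  preimage-norm : ∀ i u → preimage k i (norm k (i , u)) ≡ just u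
  preimage-norm zero u = refl
  preimage-norm (suc zero) u with _≟V_ {k} u (cL k)
  ... | yes refl rewrite ==-refl k (cU k) = refl
  ... | no u≢cL  rewrite ≢⇒==-false k u≢cL = refl
  preimage-norm (suc (suc zero)) u with _≟V_ {k} u (cL k) | _≟V_ {k} u (cU k)
  ... | yes refl | _        rewrite ==-refl k (cR k) = refl
  ... | no _     | yes refl rewrite ==-refl k (cR k) = refl
  ... | no u≢cL  | no u≢cU  rewrite ≢⇒==-false k u≢cL | ≢⇒==-false k u≢cU = refl

  preimage-just : ∀ i p {u} → preimage k i p ≡ just u → norm k (i , u) ≡ p
  preimage-just zero (zero , w) refl = refl
  preimage-just zero (suc _ , w) ()
  preimage-just (suc zero) (zero , w) h with _≟V_ {k} w (cU k)
  preimage-just (suc zero) (zero , w) refl | yes refl = norm-copyU-cL k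
  preimage-just (suc zero) (zero , w) ()   | no _
  preimage-just (suc zero) (suc zero , w) h with _≟V_ {k} w (cL k)
  preimage-just (suc zero) (suc zero , w) ()   | yes _
  preimage-just (suc zero) (suc zero , w) refl | no w≢cL rewrite ≢⇒==-false k w≢cL = refl
  preimage-just (suc zero) (suc (suc zero) , w) ()
  preimage-just (suc (suc zero)) (zero , w) h with _≟V_ {k} w (cR k)
  preimage-just (suc (suc zero)) (zero , w) refl | yes refl = norm-copyR-cL k
  preimage-just (suc (suc zero)) (zero , w) ()   | no _
  preimage-just (suc (suc zero)) (suc zero , w) h with _≟V_ {k} w (cR k)
  preimage-just (suc (suc zero)) (suc zero , w) refl | yes refl = norm-copyR-cU k
  preimage-just (suc (suc zero)) (suc zero , w) ()   | no _
  preimage-just (suc (suc zero)) (suc (suc zero) , w) h with _≟V_ {k} w (cL k) | _≟V_ {k} w (cU k)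
  preimage-just (suc (suc zero)) (suc (suc zero) , w) ()   | yes _ | _
  preimage-just (suc (suc zero)) (suc (suc zero) , w) ()   | no _  | yes _
  preimage-just (suc (suc zero)) (suc (suc zero) , w) refl | no w≢cL | no w≢cU
    rewrite ≢⇒==-false k w≢cL | ≢⇒==-false k w≢cU = refl

matches : ∀ k → Maybe (Vtx k) → Vtx k → Bool
matches k nothing  u = false
matches k (just q) u = _==_ {k} q u

==-norm : ∀ k i p u → _==_ {suc k} p (norm k (i , u)) ≡ matches k (preimage k i p) u
==-norm k i p u = ⇔→≡ {z = true} (mk⇔ to from)
  where
  to : _==_ {suc k} p (norm k (i , u)) ≡ true → matches k (preimage k i p) u ≡ true
  to h rewrite ==⇒≡ (suc k) {p} {norm k (i , u)} h | preimage-norm k i u = ==-refl k u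
  from : matches k (preimage k i p) u ≡ true → _==_ {suc k} p (norm k (i , u)) ≡ true
  from h with preimage k i p in eq
  ... | just q rewrite ==⇒≡ k h | preimage-just k i p eq = ==-refl (suc k) p

glueEdge : ∀ k → Fin 3 → Edge k → Edge (suc k)
glueEdge k i (u , v , l) = norm k (i , u) , norm k (i , v) , l

glue : ∀ k → (S₀ S₁ S₂ : List (Edge k)) → List (Edge (suc k))
glue k S₀ S₁ S₂ = map (glueEdge k copyL) S₀ ++ (map (glueEdge k copyU) S₁ ++ map (glueEdge k copyR) S₂)

∑-subsets-edges-suc : ∀ k (F : List (Edge (suc k)) → ℚ) →
  ∑ (subsets (edges (suc k))) F ≡
  ∑[ S₀ ← subsets (edges k) ] ∑[ S₁ ← subsets (edges k) ] ∑[ S₂ ← subsets (edges k) ] F (glue k S₀ S₁ S₂)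
∑-subsets-edges-suc k F = begin
  ∑ (subsets (E₀ ++ (E₁ ++ (E₂ ++ [])))) F
    ≡⟨ cong (λ E → ∑ (subsets (E₀ ++ (E₁ ++ E))) F) (++-identityʳ E₂) ⟩
  ∑ (subsets (E₀ ++ (E₁ ++ E₂))) F
    ≡⟨ ∑-subsets-++ E₀ (E₁ ++ E₂) F ⟩
  ∑[ T₀ ← subsets E₀ ] ∑[ T ← subsets (E₁ ++ E₂) ] F (T₀ ++ T)
    ≡⟨ ∑-cong (subsets E₀) (λ T₀ → ∑-subsets-++ E₁ E₂ (λ T → F (T₀ ++ T))) ⟩
  ∑[ T₀ ← subsets E₀ ] ∑[ T₁ ← subsets E₁ ] ∑[ T₂ ← subsets E₂ ] F (T₀ ++ (T₁ ++ T₂))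
    ≡⟨ ∑-subsets-map (glueEdge k copyL) (edges k) _ ⟩
  ∑[ S₀ ← subsets (edges k) ] ∑[ T₁ ← subsets E₁ ] ∑[ T₂ ← subsets E₂ ]
    F (map (glueEdge k copyL) S₀ ++ (T₁ ++ T₂))
    ≡⟨ ∑-cong (subsets (edges k)) (λ S₀ → ∑-subsets-map (glueEdge k copyU) (edges k) _) ⟩
  ∑[ S₀ ← subsets (edges k) ] ∑[ S₁ ← subsets (edges k) ] ∑[ T₂ ← subsets E₂ ]
    F (map (glueEdge k copyL) S₀ ++ (map (glueEdge k copyU) S₁ ++ T₂))
    ≡⟨ ∑-cong (subsets (edges k)) (λ S₀ → ∑-cong (subsets (edges k)) (λ S₁ →
         ∑-subsets-map (glueEdge k copyR) (edges k) _)) ⟩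
  ∑[ S₀ ← subsets (edges k) ] ∑[ S₁ ← subsets (edges k) ] ∑[ S₂ ← subsets (edges k) ] F (glue k S₀ S₁ S₂)
    ∎
  where
  open ≡-Reasoning
  E₀ E₁ E₂ : List (Edge (suc k))
  E₀ = map (glueEdge k copyL) (edges k)
  E₁ = map (glueEdge k copyU) (edges k)
  E₂ = map (glueEdge k copyR) (edges k)

degAt : ∀ k → List (Edge k) → Maybe (Vtx k) → ℕ
degAt k M nothing  = 0
degAt k M (just q) = deg k M q

module _ (k : ℕ) where

  deg-map-glueEdge : ∀ i S p → deg (suc k) (map (glueEdge k i) S) p ≡ degAt k S (preimage k i p)
  deg-map-glueEdge i S p =
    trans (count-map _ (λ e → matches k (preimage k i p) (proj₁ e) ∨ matches k (preimage k i p) (proj₁ (proj₂ e)))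
                     (glueEdge k i) (λ e → cong₂ _∨_ (==-norm k i p (proj₁ e)) (==-norm k i p (proj₁ (proj₂ e)))) S)
          (by-preimage (preimage k i p))
    where
    by-preimage : ∀ m → count (λ e → matches k m (proj₁ e) ∨ matches k m (proj₁ (proj₂ e))) S ≡ degAt k S m
    by-preimage nothing  = count-false S
    by-preimage (just q) = refl

  deg-glue : ∀ S₀ S₁ S₂ p → deg (suc k) (glue k S₀ S₁ S₂) p ≡
             degAt k S₀ (preimage k copyL p) ℕ.+ (degAt k S₁ (preimage k copyU p) ℕ.+ degAt k S₂ (preimage k copyR p))
  deg-glue S₀ S₁ S₂ p = begin
    deg (suc k) (glue k S₀ S₁ S₂) p
      ≡⟨ count-++ _ (map (glueEdge k copyL) S₀) _ ⟩
    deg (suc k) (map (glueEdge k copyL) S₀) p ℕ.+ deg (suc k) (map (glueEdge k copyU) S₁ ++ map (glueEdge k copyR) S₂) p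
      ≡⟨ cong (deg (suc k) (map (glueEdge k copyL) S₀) p ℕ.+_) (count-++ _ (map (glueEdge k copyU) S₁) _) ⟩
    deg (suc k) (map (glueEdge k copyL) S₀) p ℕ.+
      (deg (suc k) (map (glueEdge k copyU) S₁) p ℕ.+ deg (suc k) (map (glueEdge k copyR) S₂) p)
      ≡⟨ cong₂ ℕ._+_ (deg-map-glueEdge copyL S₀ p)
           (cong₂ ℕ._+_ (deg-map-glueEdge copyU S₁ p) (deg-map-glueEdge copyR S₂ p)) ⟩
    degAt k S₀ (preimage k copyL p) ℕ.+ (degAt k S₁ (preimage k copyU p) ℕ.+ degAt k S₂ (preimage k copyR p))
      ∎
    where open ≡-Reasoning

data Position k : Vtx k → Set where
  atL      : Position k (cL k)
  atU      : Position k (cU k)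
  atR      : Position k (cR k)
  interior : ∀ {v} → v ≢ cL k → v ≢ cU k → v ≢ cR k → Position k v

position : ∀ k v → Position k v
position k v with _≟V_ {k} v (cL k) | _≟V_ {k} v (cU k) | _≟V_ {k} v (cR k)
... | yes refl | _        | _        = atL
... | no _     | yes refl | _        = atU
... | no _     | no _     | yes refl = atR
... | no v≢cL  | no v≢cU  | no v≢cR  = interior v≢cL v≢cU v≢cR

module _ (k : ℕ) where

  isCorner-cL : isCorner k (cL k) ≡ true
  isCorner-cL rewrite ==-refl k (cL k) = refl

  isCorner-cU : isCorner k (cU k) ≡ true
  isCorner-cU rewrite ==-refl k (cU k) | ≢⇒==-false k (cL≢cU k ∘ sym) = refl

  isCorner-cR : isCorner k (cR k) ≡ true
  isCorner-cR rewrite ==-refl k (cR k) | ≢⇒==-false k (cL≢cR k ∘ sym) | ≢⇒==-false k (cU≢cR k ∘ sym) = refl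

  isCorner-interior : ∀ {v} → v ≢ cL k → v ≢ cU k → v ≢ cR k → isCorner k v ≡ false
  isCorner-interior v≢cL v≢cU v≢cR
    rewrite ≢⇒==-false k v≢cL | ≢⇒==-false k v≢cU | ≢⇒==-false k v≢cR = refl

  isCorner-suc : ∀ i w → isCorner (suc k) (i , w) ≡
    (does (i ≟F copyL) ∧ _==_ {k} w (cL k)) ∨
    (does (i ≟F copyU) ∧ _==_ {k} w (cU k)) ∨
    (does (i ≟F copyR) ∧ _==_ {k} w (cR k))
  isCorner-suc i w rewrite ==-pair k i copyL w (cL k) | ==-pair k i copyU w (cU k) | ==-pair k i copyR w (cR k) = refl

  isCorner-LU-junction : isCorner (suc k) (copyL , cU k) ≡ false
  isCorner-LU-junction rewrite isCorner-suc copyL (cU k) | ≢⇒==-false k (cL≢cU k ∘ sym) = refl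

  isCorner-LR-junction : isCorner (suc k) (copyL , cR k) ≡ false
  isCorner-LR-junction rewrite isCorner-suc copyL (cR k) | ≢⇒==-false k (cL≢cR k ∘ sym) = refl

  isCorner-UR-junction : isCorner (suc k) (copyU , cR k) ≡ false
  isCorner-UR-junction rewrite isCorner-suc copyU (cR k) | ≢⇒==-false k (cU≢cR k ∘ sym) = refl

  isCorner-norm-interior : ∀ i {v} → v ≢ cL k → v ≢ cU k → v ≢ cR k → isCorner (suc k) (norm k (i , v)) ≡ false
  isCorner-norm-interior zero {v} v≢cL _ _ rewrite isCorner-suc copyL v | ≢⇒==-false k v≢cL = refl
  isCorner-norm-interior (suc zero) {v} v≢cL v≢cU _
    rewrite ≢⇒==-false k v≢cL | isCorner-suc copyU v | ≢⇒==-false k v≢cU = refl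
  isCorner-norm-interior (suc (suc zero)) {v} v≢cL v≢cU v≢cR
    rewrite ≢⇒==-false k v≢cL | ≢⇒==-false k v≢cU | isCorner-suc copyR v | ≢⇒==-false k v≢cR = refl

-- Matchings covering the non-corner vertices

DimerDegree : ℕ → Bool → Set
DimerDegree d corner = ((d ≤ᵇ 1) ≡ true) × ((corner ∨ (d ≡ᵇ 1)) ≡ true)

DimerAt : ∀ k → List (Edge k) → Vtx k → Set
DimerAt k M v = DimerDegree (deg k M v) (isCorner k v)

InnerDimer : ∀ k → List (Edge k) → Set
InnerDimer k M = ∀ v → v ∈ vertices k → DimerAt k M v

isInnerDimer : ∀ k → List (Edge k) → Bool
isInnerDimer k M =
  allL (λ v → deg k M v ≤ᵇ 1) (vertices k) ∧ allL (λ v → isCorner k v ∨ (deg k M v ≡ᵇ 1)) (vertices k)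

module _ (k : ℕ) (M : List (Edge k)) where

  isInnerDimer⇒InnerDimer : isInnerDimer k M ≡ true → InnerDimer k M
  isInnerDimer⇒InnerDimer h v v∈ =
    allL⇒∈ _ (vertices k) (∧-trueˡ _ h) v v∈ , allL⇒∈ _ (vertices k) (∧-trueʳ _ h) v v∈

  InnerDimer⇒isInnerDimer : InnerDimer k M → isInnerDimer k M ≡ true
  InnerDimer⇒isInnerDimer h =
    ∧-true (∈⇒allL _ (vertices k) (λ v → proj₁ ∘ h v)) (∈⇒allL _ (vertices k) (λ v → proj₂ ∘ h v))

DimerDegree-+ˡ : ∀ m e {corner} → DimerDegree (m ℕ.+ e) corner → DimerDegree m true
DimerDegree-+ˡ zero          e _ = refl , refl
DimerDegree-+ˡ (suc zero)    e _ = refl , refl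
DimerDegree-+ˡ (suc (suc m)) e (() , _)

DimerDegree-junction⁻ : ∀ m n → DimerDegree (m ℕ.+ n) false → ((m ≡ᵇ 1) xor (n ≡ᵇ 1)) ≡ true
DimerDegree-junction⁻ zero          n       (_ , h) = h
DimerDegree-junction⁻ (suc zero)    zero    _       = refl
DimerDegree-junction⁻ (suc zero)    (suc n) (() , _)
DimerDegree-junction⁻ (suc (suc m)) n       (() , _)

DimerDegree-junction : ∀ m n → DimerDegree m true → DimerDegree n true → ((m ≡ᵇ 1) xor (n ≡ᵇ 1)) ≡ true →
                       DimerDegree (m ℕ.+ n) false
DimerDegree-junction zero          (suc zero)    _ _ _ = refl , refl
DimerDegree-junction (suc zero)    zero          _ _ _ = refl , refl
DimerDegree-junction zero          zero          _ _ ()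
DimerDegree-junction (suc zero)    (suc zero)    _ _ ()
DimerDegree-junction zero          (suc (suc n)) _ (() , _) _
DimerDegree-junction (suc zero)    (suc (suc n)) _ (() , _) _
DimerDegree-junction (suc (suc m)) n             (() , _) _ _

CornerState : Set
CornerState = Bool × Bool × Bool

cornerState : ∀ k → List (Edge k) → CornerState
cornerState k M = (deg k M (cL k) ≡ᵇ 1) , (deg k M (cU k) ≡ᵇ 1) , (deg k M (cR k) ≡ᵇ 1)

-- Each junction is covered from exactly one of the two copies meeting there.
compatible : CornerState → CornerState → CornerState → Bool
compatible (_ , u₀ , r₀) (l₁ , _ , r₁) (l₂ , u₂ , _) = (u₀ xor l₁) ∧ ((r₀ xor l₂) ∧ (r₁ xor u₂))

junctionState : CornerState → CornerState → CornerState
junctionState (_ , u₀ , r₀) (_ , _ , r₁) = u₀ , r₀ , r₁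

outerState : CornerState → CornerState → CornerState → CornerState
outerState (l₀ , _ , _) (_ , u₁ , _) (_ , _ , r₂) = l₀ , u₁ , r₂

module Glue (k : ℕ) (S₀ S₁ S₂ : List (Edge k)) where

  G : List (Edge (suc k))
  G = glue k S₀ S₁ S₂

  copy : Fin 3 → List (Edge k)
  copy zero             = S₀
  copy (suc zero)       = S₁
  copy (suc (suc zero)) = S₂

  d₀ d₁ d₂ : Vtx k → ℕ
  d₀ = deg k S₀
  d₁ = deg k S₁
  d₂ = deg k S₂

  deg-cL : deg (suc k) G (copyL , cL k) ≡ d₀ (cL k)
  deg-cL rewrite deg-glue k S₀ S₁ S₂ (copyL , cL k)
               | ≢⇒==-false k (cL≢cU k) | ≢⇒==-false k (cL≢cR k) = ℕₚ.+-identityʳ _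

  deg-cU : deg (suc k) G (copyU , cU k) ≡ d₁ (cU k)
  deg-cU rewrite deg-glue k S₀ S₁ S₂ (copyU , cU k)
               | ≢⇒==-false k (cL≢cU k ∘ sym) | ≢⇒==-false k (cU≢cR k) = ℕₚ.+-identityʳ _

  deg-cR : deg (suc k) G (copyR , cR k) ≡ d₂ (cR k)
  deg-cR rewrite deg-glue k S₀ S₁ S₂ (copyR , cR k)
               | ≢⇒==-false k (cL≢cR k ∘ sym) | ≢⇒==-false k (cU≢cR k ∘ sym) = refl

  deg-LU-junction : deg (suc k) G (copyL , cU k) ≡ d₀ (cU k) ℕ.+ d₁ (cL k)
  deg-LU-junction rewrite deg-glue k S₀ S₁ S₂ (copyL , cU k)
                        | ≢⇒==-false k (cU≢cR k) | ==-refl k (cU k) = cong (d₀ (cU k) ℕ.+_) (ℕₚ.+-identityʳ _)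

  deg-LR-junction : deg (suc k) G (copyL , cR k) ≡ d₀ (cR k) ℕ.+ d₂ (cL k)
  deg-LR-junction rewrite deg-glue k S₀ S₁ S₂ (copyL , cR k)
                        | ≢⇒==-false k (cU≢cR k ∘ sym) | ==-refl k (cR k) = refl

  deg-UR-junction : deg (suc k) G (copyU , cR k) ≡ d₁ (cR k) ℕ.+ d₂ (cU k)
  deg-UR-junction rewrite deg-glue k S₀ S₁ S₂ (copyU , cR k)
                        | ≢⇒==-false k (cL≢cR k ∘ sym) | ==-refl k (cR k) = refl

  deg-interior : ∀ i {v} → v ≢ cL k → v ≢ cU k → v ≢ cR k → deg (suc k) G (norm k (i , v)) ≡ deg k (copy i) v
  deg-interior zero {v} _ v≢cU v≢cR
    rewrite deg-glue k S₀ S₁ S₂ (copyL , v) | ≢⇒==-false k v≢cU | ≢⇒==-false k v≢cR = ℕₚ.+-identityʳ _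
  deg-interior (suc zero) {v} v≢cL _ v≢cR
    rewrite ≢⇒==-false k v≢cL | deg-glue k S₀ S₁ S₂ (copyU , v) | ≢⇒==-false k v≢cL | ≢⇒==-false k v≢cR
    = ℕₚ.+-identityʳ _
  deg-interior (suc (suc zero)) {v} v≢cL v≢cU _
    rewrite ≢⇒==-false k v≢cL | ≢⇒==-false k v≢cU | deg-glue k S₀ S₁ S₂ (copyR , v)
          | ≢⇒==-false k v≢cL | ≢⇒==-false k v≢cU = refl

  deg-norm-split : ∀ i v → ∃[ e ] deg (suc k) G (norm k (i , v)) ≡ deg k (copy i) v ℕ.+ e
  deg-norm-split zero v with position k v
  ... | atL = 0 , trans deg-cL (sym (ℕₚ.+-identityʳ _))
  ... | atU = d₁ (cL k) , deg-LU-junction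
  ... | atR = d₂ (cL k) , deg-LR-junction
  ... | interior v≢cL v≢cU v≢cR = 0 , trans (deg-interior copyL v≢cL v≢cU v≢cR) (sym (ℕₚ.+-identityʳ _))
  deg-norm-split (suc zero) v with position k v
  ... | atL = d₀ (cU k) , trans (cong (deg (suc k) G) (norm-copyU-cL k)) (trans deg-LU-junction (ℕₚ.+-comm (d₀ (cU k)) _))
  ... | atU = 0 , trans (cong (deg (suc k) G) (norm-copyU-cU k)) (trans deg-cU (sym (ℕₚ.+-identityʳ _)))
  ... | atR = d₂ (cU k) , trans (cong (deg (suc k) G) (norm-copyU-cR k)) deg-UR-junction
  ... | interior v≢cL v≢cU v≢cR = 0 , trans (deg-interior copyU v≢cL v≢cU v≢cR) (sym (ℕₚ.+-identityʳ _))
  deg-norm-split (suc (suc zero)) v with position k v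
  ... | atL = d₀ (cR k) , trans (cong (deg (suc k) G) (norm-copyR-cL k)) (trans deg-LR-junction (ℕₚ.+-comm (d₀ (cR k)) _))
  ... | atU = d₁ (cR k) , trans (cong (deg (suc k) G) (norm-copyR-cU k)) (trans deg-UR-junction (ℕₚ.+-comm (d₁ (cR k)) _))
  ... | atR = 0 , trans (cong (deg (suc k) G) (norm-copyR-cR k)) (trans deg-cR (sym (ℕₚ.+-identityʳ _)))
  ... | interior v≢cL v≢cU v≢cR = 0 , trans (deg-interior copyR v≢cL v≢cU v≢cR) (sym (ℕₚ.+-identityʳ _))

  isCorner-norm-interior-≡ : ∀ i {v} → v ≢ cL k → v ≢ cU k → v ≢ cR k →
                             isCorner (suc k) (norm k (i , v)) ≡ isCorner k v
  isCorner-norm-interior-≡ i ne₁ ne₂ ne₃ =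
    trans (isCorner-norm-interior k i ne₁ ne₂ ne₃) (sym (isCorner-interior k ne₁ ne₂ ne₃))

  copiesCompatible : Bool
  copiesCompatible = compatible (cornerState k S₀) (cornerState k S₁) (cornerState k S₂)

  InnerDimer-copy-corner : InnerDimer (suc k) G → ∀ i {v} → v ∈ vertices k → isCorner k v ≡ true →
                           DimerAt k (copy i) v
  InnerDimer-copy-corner inner i {v} v∈ corner with deg-norm-split i v
  ... | e , split = subst (DimerDegree (deg k (copy i) v)) (sym corner)
                      (DimerDegree-+ˡ (deg k (copy i) v) e
                        (subst (λ d → DimerDegree d (isCorner (suc k) (norm k (i , v)))) split
                          (inner _ (norm-∈-vertices k i v∈))))

  InnerDimer-copy : InnerDimer (suc k) G → ∀ i → InnerDimer k (copy i)
  InnerDimer-copy inner i v v∈ with position k v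
  ... | atL = InnerDimer-copy-corner inner i v∈ (isCorner-cL k)
  ... | atU = InnerDimer-copy-corner inner i v∈ (isCorner-cU k)
  ... | atR = InnerDimer-copy-corner inner i v∈ (isCorner-cR k)
  ... | interior ne₁ ne₂ ne₃ =
    subst₂ DimerDegree (deg-interior i ne₁ ne₂ ne₃) (isCorner-norm-interior-≡ i ne₁ ne₂ ne₃)
      (inner _ (norm-∈-vertices k i v∈))

  InnerDimer⇒compatible : InnerDimer (suc k) G → copiesCompatible ≡ true
  InnerDimer⇒compatible inner = ∧-true LU (∧-true LR UR)
    where
    LU : ((d₀ (cU k) ≡ᵇ 1) xor (d₁ (cL k) ≡ᵇ 1)) ≡ true
    LU = DimerDegree-junction⁻ (d₀ (cU k)) (d₁ (cL k))
           (subst₂ DimerDegree deg-LU-junction (isCorner-LU-junction k) (inner _ (norm-∈-vertices k copyL (cU∈vertices k))))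
    LR : ((d₀ (cR k) ≡ᵇ 1) xor (d₂ (cL k) ≡ᵇ 1)) ≡ true
    LR = DimerDegree-junction⁻ (d₀ (cR k)) (d₂ (cL k))
           (subst₂ DimerDegree deg-LR-junction (isCorner-LR-junction k) (inner _ (norm-∈-vertices k copyL (cR∈vertices k))))
    UR : ((d₁ (cR k) ≡ᵇ 1) xor (d₂ (cU k) ≡ᵇ 1)) ≡ true
    UR = DimerDegree-junction⁻ (d₁ (cR k)) (d₂ (cU k))
           (subst₂ DimerDegree deg-UR-junction (isCorner-UR-junction k)
             (inner _ (subst (_∈ vertices (suc k)) (norm-copyU-cR k) (norm-∈-vertices k copyU (cR∈vertices k)))))

  module _ (inner : ∀ i → InnerDimer k (copy i)) (compat : copiesCompatible ≡ true) where

    DimerAt-corner : ∀ i {v} → v ∈ vertices k → isCorner k v ≡ true → DimerDegree (deg k (copy i) v) true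
    DimerAt-corner i {v} v∈ corner = subst (DimerDegree (deg k (copy i) v)) corner (inner i v v∈)

    DimerAt-outer : ∀ p i {v} → v ∈ vertices k → isCorner k v ≡ true →
                    deg (suc k) G p ≡ deg k (copy i) v → isCorner (suc k) p ≡ true → DimerAt (suc k) G p
    DimerAt-outer p i v∈ cv dp cp = subst₂ DimerDegree (sym dp) (sym cp) (DimerAt-corner i v∈ cv)

    DimerAt-junction : ∀ p i j {v w} → v ∈ vertices k → w ∈ vertices k → isCorner k v ≡ true → isCorner k w ≡ true →
                       deg (suc k) G p ≡ deg k (copy i) v ℕ.+ deg k (copy j) w → isCorner (suc k) p ≡ false →
                       ((deg k (copy i) v ≡ᵇ 1) xor (deg k (copy j) w ≡ᵇ 1)) ≡ true → DimerAt (suc k) G p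
    DimerAt-junction p i j {v} {w} v∈ w∈ cv cw split notCorner exactlyOne =
      subst₂ DimerDegree (sym split) (sym notCorner)
        (DimerDegree-junction (deg k (copy i) v) (deg k (copy j) w)
          (DimerAt-corner i v∈ cv) (DimerAt-corner j w∈ cw) exactlyOne)

    LU-xor LR-xor : Bool
    LU-xor = (d₀ (cU k) ≡ᵇ 1) xor (d₁ (cL k) ≡ᵇ 1)
    LR-xor = (d₀ (cR k) ≡ᵇ 1) xor (d₂ (cL k) ≡ᵇ 1)

    DimerAt-LU : DimerAt (suc k) G (copyL , cU k)
    DimerAt-LU = DimerAt-junction (copyL , cU k) copyL copyU (cU∈vertices k) (cL∈vertices k) (isCorner-cU k) (isCorner-cL k)
                  deg-LU-junction (isCorner-LU-junction k) (∧-trueˡ LU-xor compat)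

    DimerAt-LR : DimerAt (suc k) G (copyL , cR k)
    DimerAt-LR = DimerAt-junction (copyL , cR k) copyL copyR (cR∈vertices k) (cL∈vertices k) (isCorner-cR k) (isCorner-cL k)
                  deg-LR-junction (isCorner-LR-junction k) (∧-trueˡ LR-xor (∧-trueʳ LU-xor compat))

    DimerAt-UR : DimerAt (suc k) G (copyU , cR k)
    DimerAt-UR = DimerAt-junction (copyU , cR k) copyU copyR (cR∈vertices k) (cU∈vertices k) (isCorner-cR k) (isCorner-cU k)
                  deg-UR-junction (isCorner-UR-junction k) (∧-trueʳ LR-xor (∧-trueʳ LU-xor compat))

    DimerAt-norm : ∀ i {v} → v ∈ vertices k → DimerAt (suc k) G (norm k (i , v))
    DimerAt-norm i {v} v∈ with position k v
    DimerAt-norm i v∈ | interior ne₁ ne₂ ne₃ =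
      subst₂ DimerDegree (sym (deg-interior i ne₁ ne₂ ne₃)) (sym (isCorner-norm-interior-≡ i ne₁ ne₂ ne₃))
        (inner i _ v∈)
    DimerAt-norm zero v∈ | atL = DimerAt-outer (copyL , cL k) copyL v∈ (isCorner-cL k) deg-cL (isCorner-cL (suc k))
    DimerAt-norm zero v∈ | atU = DimerAt-LU
    DimerAt-norm zero v∈ | atR = DimerAt-LR
    DimerAt-norm (suc zero) v∈ | atL = subst (DimerAt (suc k) G) (sym (norm-copyU-cL k)) DimerAt-LU
    DimerAt-norm (suc zero) v∈ | atU = subst (DimerAt (suc k) G) (sym (norm-copyU-cU k))
      (DimerAt-outer (copyU , cU k) copyU v∈ (isCorner-cU k) deg-cU (isCorner-cU (suc k)))
    DimerAt-norm (suc zero) v∈ | atR = subst (DimerAt (suc k) G) (sym (norm-copyU-cR k)) DimerAt-UR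
    DimerAt-norm (suc (suc zero)) v∈ | atL = subst (DimerAt (suc k) G) (sym (norm-copyR-cL k)) DimerAt-LR
    DimerAt-norm (suc (suc zero)) v∈ | atU = subst (DimerAt (suc k) G) (sym (norm-copyR-cU k)) DimerAt-UR
    DimerAt-norm (suc (suc zero)) v∈ | atR = subst (DimerAt (suc k) G) (sym (norm-copyR-cR k))
      (DimerAt-outer (copyR , cR k) copyR v∈ (isCorner-cR k) deg-cR (isCorner-cR (suc k)))

    InnerDimer-glue : InnerDimer (suc k) G
    InnerDimer-glue p p∈ with vertices-suc⁻ k p∈
    ... | i , v , v∈ , refl = DimerAt-norm i v∈

  isInnerDimer-glue : isInnerDimer (suc k) G ≡
    isInnerDimer k S₀ ∧ (isInnerDimer k S₁ ∧ (isInnerDimer k S₂ ∧ copiesCompatible))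
  isInnerDimer-glue = ⇔→≡ {z = true} (mk⇔ to from)
    where
    to : isInnerDimer (suc k) G ≡ true →
         (isInnerDimer k S₀ ∧ (isInnerDimer k S₁ ∧ (isInnerDimer k S₂ ∧ copiesCompatible))) ≡ true
    to h = ∧-true (inner copyL) (∧-true (inner copyU) (∧-true (inner copyR) (InnerDimer⇒compatible glued)))
      where
      glued : InnerDimer (suc k) G
      glued = isInnerDimer⇒InnerDimer (suc k) G h
      inner : ∀ i → isInnerDimer k (copy i) ≡ true
      inner i = InnerDimer⇒isInnerDimer k (copy i) (InnerDimer-copy glued i)
    from : (isInnerDimer k S₀ ∧ (isInnerDimer k S₁ ∧ (isInnerDimer k S₂ ∧ copiesCompatible))) ≡ true →
           isInnerDimer (suc k) G ≡ true
    from h = InnerDimer⇒isInnerDimer (suc k) G (InnerDimer-glue inner (∧-trueʳ (isInnerDimer k S₂) h₂))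
      where
      h₁ : (isInnerDimer k S₁ ∧ (isInnerDimer k S₂ ∧ copiesCompatible)) ≡ true
      h₁ = ∧-trueʳ (isInnerDimer k S₀) h
      h₂ : (isInnerDimer k S₂ ∧ copiesCompatible) ≡ true
      h₂ = ∧-trueʳ (isInnerDimer k S₁) h₁
      inner : ∀ i → InnerDimer k (copy i)
      inner zero             = isInnerDimer⇒InnerDimer k S₀ (∧-trueˡ (isInnerDimer k S₀) h)
      inner (suc zero)       = isInnerDimer⇒InnerDimer k S₁ (∧-trueˡ (isInnerDimer k S₁) h₁)
      inner (suc (suc zero)) = isInnerDimer⇒InnerDimer k S₂ (∧-trueˡ (isInnerDimer k S₂) h₂)

  cornerState-glue : cornerState (suc k) G ≡ outerState (cornerState k S₀) (cornerState k S₁) (cornerState k S₂)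
  cornerState-glue rewrite deg-cL | deg-cU | deg-cR = refl

_≟ˢ_ : DecidableEquality CornerState
_≟ˢ_ = ≡-dec Bool._≟_ (≡-dec Bool._≟_ Bool._≟_)

_=ˢ_ : CornerState → CornerState → Bool
s =ˢ t = does (s ≟ˢ t)

cornerStates : List CornerState
cornerStates =
  (true , true , true) ∷ (true , true , false) ∷ (true , false , true) ∷ (true , false , false) ∷
  (false , true , true) ∷ (false , true , false) ∷ (false , false , true) ∷ (false , false , false) ∷ []

∈-cornerStates : ∀ t → t ∈ cornerStates
∈-cornerStates (true  , true  , true ) = here refl
∈-cornerStates (true  , true  , false) = there (here refl)
∈-cornerStates (true  , false , true ) = there (there (here refl))
∈-cornerStates (true  , false , false) = there (there (there (here refl)))
∈-cornerStates (false , true  , true ) = there (there (there (there (here refl))))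
∈-cornerStates (false , true  , false) = there (there (there (there (there (here refl)))))
∈-cornerStates (false , false , true ) = there (there (there (there (there (there (here refl))))))
∈-cornerStates (false , false , false) = there (there (there (there (there (there (there (here refl)))))))

allStates : (CornerState → Bool) → Bool
allStates f = allOf f cornerStates

allStates⇒ : ∀ f → T (allStates f) → ∀ t → T (f t)
allStates⇒ f h t = allOf⇒ f cornerStates h (∈-cornerStates t)

allStates⁵⇒ : (f : CornerState → CornerState → CornerState → CornerState → CornerState → Bool) →
              T (allStates λ t → allStates λ s → allStates λ c₀ → allStates λ c₁ → allStates (f t s c₀ c₁)) →
              ∀ t s c₀ c₁ c₂ → T (f t s c₀ c₁ c₂)
allStates⁵⇒ f h t s c₀ c₁ =
  allStates⇒ (f t s c₀ c₁) (allStates⇒ (λ c₁ → allStates (f t s c₀ c₁))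
    (allStates⇒ (λ c₀ → allStates λ c₁ → allStates (f t s c₀ c₁))
      (allStates⇒ (λ s → allStates λ c₀ → allStates λ c₁ → allStates (f t s c₀ c₁))
        (allStates⇒ (λ t → allStates λ s → allStates λ c₀ → allStates λ c₁ → allStates (f t s c₀ c₁)) h t) s) c₀) c₁)

∑-=ˢ : ∀ κ (f : CornerState → ℚ) → ∑[ s ← cornerStates ] [ s =ˢ κ ]· f s ≡ f κ
∑-=ˢ κ f =
  trans (sym (∑-filter (_=ˢ κ) cornerStates f)) (trans (cong (λ ss → ∑ ss f) (filter-=ˢ κ)) (+-identityʳ (f κ)))
  where
  filter-=ˢ : ∀ κ → filter (λ s → T? (s =ˢ κ)) cornerStates ≡ κ ∷ []
  filter-=ˢ (true  , true  , true ) = refl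
  filter-=ˢ (true  , true  , false) = refl
  filter-=ˢ (true  , false , true ) = refl
  filter-=ˢ (true  , false , false) = refl
  filter-=ˢ (false , true  , true ) = refl
  filter-=ˢ (false , true  , false) = refl
  filter-=ˢ (false , false , true ) = refl
  filter-=ˢ (false , false , false) = refl

-- Corner states of the copies Γ^L, Γ^U, Γ^R of a matching with outer state t, where s
-- records whether the junctions LU, LR, UR are covered from Γ^L, Γ^L, Γ^U respectively.
stateL stateU stateR : CornerState → CornerState → CornerState
stateL (l , _ , _) (s₁ , s₂ , _ ) = l , s₁ , s₂
stateU (_ , u , _) (s₁ , _  , s₃) = not s₁ , u , s₃
stateR (_ , _ , r) (_  , s₂ , s₃) = not s₂ , not s₃ , r

-- Checked by evaluating all 8⁵ cases.
copyStates-match : ∀ t s c₀ c₁ c₂ →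
  ((stateL t s =ˢ c₀) ∧ ((stateU t s =ˢ c₁) ∧ (stateR t s =ˢ c₂))) ≡
  ((s =ˢ junctionState c₀ c₁) ∧ (compatible c₀ c₁ c₂ ∧ (t =ˢ outerState c₀ c₁ c₂)))
copyStates-match t s c₀ c₁ c₂ =
  toWitness {a? = lhs t s c₀ c₁ c₂ Bool.≟ rhs t s c₀ c₁ c₂} (allStates⁵⇒ agree _ t s c₀ c₁ c₂)
  where
  lhs rhs agree : CornerState → CornerState → CornerState → CornerState → CornerState → Bool
  lhs t s c₀ c₁ c₂ = (stateL t s =ˢ c₀) ∧ ((stateU t s =ˢ c₁) ∧ (stateR t s =ˢ c₂))
  rhs t s c₀ c₁ c₂ = (s =ˢ junctionState c₀ c₁) ∧ (compatible c₀ c₁ c₂ ∧ (t =ˢ outerState c₀ c₁ c₂))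
  agree t s c₀ c₁ c₂ = isYes (lhs t s c₀ c₁ c₂ Bool.≟ rhs t s c₀ c₁ c₂)

-- The corner-resolved partition function

odd : ℕ → Bool
odd zero    = false
odd (suc k) = not (odd k)

%2-suc-suc : ∀ k → suc (suc k) % 2 ≡ k % 2
%2-suc-suc k = trans (cong (_% 2) (ℕₚ.+-comm 2 k)) ([m+n]%n≡m%n k 2)

odd≡%2≡ᵇ1 : ∀ k → (k % 2 ≡ᵇ 1) ≡ odd k
odd≡%2≡ᵇ1 zero          = refl
odd≡%2≡ᵇ1 (suc zero)    = refl
odd≡%2≡ᵇ1 (suc (suc k)) =
  trans (cong (_≡ᵇ 1) (%2-suc-suc k)) (trans (odd≡%2≡ᵇ1 k) (sym (Bool.not-involutive (odd k))))

odd-from-%2 : ∀ k {r} → suc (suc k) % 2 ≡ r → odd k ≡ (r ≡ᵇ 1)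
odd-from-%2 k {r} n%2≡r = trans (sym (odd≡%2≡ᵇ1 k)) (cong (_≡ᵇ 1) (trans (sym (%2-suc-suc k)) n%2≡r))

coveredCount : CornerState → ℕ
coveredCount (l , u , r) = count (λ b → b) (l ∷ u ∷ r ∷ [])

admissibleCount : Bool → ℕ → Bool
admissibleCount isOdd n = if isOdd then (n ≡ᵇ 0) ∨ (n ≡ᵇ 2) else (n ≡ᵇ 1) ∨ (n ≡ᵇ 3)

admissible : Bool → CornerState → Bool
admissible isOdd t = admissibleCount isOdd (coveredCount t)

isDimer-inner : ∀ k M → isDimer k M ≡ isInnerDimer k M ∧ admissible (odd k) (cornerState k M)
isDimer-inner k M =
  trans (sym (Bool.∧-assoc (allL (λ v → deg k M v ≤ᵇ 1) (vertices k)) _ _))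
        (cong₂ (λ isOdd n → isInnerDimer k M ∧ admissibleCount isOdd n) (odd≡%2≡ᵇ1 k) coveredCorners≡)
  where
  coveredCorners≡ : coveredCorners k M ≡ coveredCount (cornerState k M)
  coveredCorners≡ =
    sym (count-map (λ b → b) (λ v → deg k M v ≡ᵇ 1) (λ v → deg k M v ≡ᵇ 1) (λ _ → refl) (cL k ∷ cU k ∷ cR k ∷ []))

module StateAlgebra {C : Set} (_⊕_ _⊗_ : C → C → C) (0c 2c : C) where

  glueStep : (CornerState → C) → CornerState → C
  glueStep f t = sumWith _⊕_ 0c cornerStates λ s → f (stateL t s) ⊗ (f (stateU t s) ⊗ f (stateR t s))

  stateValue : Bool → C → C → CornerState → C
  stateValue false P Q (true  , true  , true ) = P
  stateValue false P Q (true  , false , false) = Q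
  stateValue false P Q (false , true  , false) = Q
  stateValue false P Q (false , false , true ) = Q
  stateValue true  P Q (false , true  , true ) = P
  stateValue true  P Q (true  , false , true ) = P
  stateValue true  P Q (true  , true  , false) = P
  stateValue true  P Q (false , false , false) = Q
  stateValue _     _ _ _                       = 0c

  nextP nextQ : Bool → C → C → C
  nextP false P Q = 2c ⊗ (P ⊗ (Q ⊗ Q))
  nextP true  P Q = 2c ⊗ (P ⊗ (P ⊗ P))
  nextQ false P Q = 2c ⊗ (Q ⊗ (Q ⊗ Q))
  nextQ true  P Q = 2c ⊗ (P ⊗ (P ⊗ Q))

  admissibleSum : Bool → (CornerState → C) → C
  admissibleSum isOdd f = sumWith _⊕_ 0c cornerStates λ t → if admissible isOdd t then f t else 0c

open StateAlgebra _+_ _*_ 0ℚ 2ℚ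

-- The same expressions over solver polynomials, so that `solve` applies to them.
module Poly (n : ℕ) = StateAlgebra {Polynomial n} _:+_ _:*_ (con 0ℚ) (con 2ℚ)

recurrenceEquation : Bool → CornerState → Polynomial 2 → Polynomial 2 → Polynomial 2 × Polynomial 2
recurrenceEquation isOdd t P Q =
  Poly.glueStep 2 (Poly.stateValue 2 isOdd P Q) t :=
  Poly.stateValue 2 (not isOdd) (Poly.nextP 2 isOdd P Q) (Poly.nextQ 2 isOdd P Q) t

glueStep-stateValue : ∀ isOdd t P Q →
  glueStep (stateValue isOdd P Q) t ≡ stateValue (not isOdd) (nextP isOdd P Q) (nextQ isOdd P Q) t
glueStep-stateValue false (true  , true  , true ) = solve 2 (recurrenceEquation false (true  , true  , true )) refl
glueStep-stateValue false (true  , true  , false) = solve 2 (recurrenceEquation false (true  , true  , false)) refl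
glueStep-stateValue false (true  , false , true ) = solve 2 (recurrenceEquation false (true  , false , true )) refl
glueStep-stateValue false (true  , false , false) = solve 2 (recurrenceEquation false (true  , false , false)) refl
glueStep-stateValue false (false , true  , true ) = solve 2 (recurrenceEquation false (false , true  , true )) refl
glueStep-stateValue false (false , true  , false) = solve 2 (recurrenceEquation false (false , true  , false)) refl
glueStep-stateValue false (false , false , true ) = solve 2 (recurrenceEquation false (false , false , true )) refl
glueStep-stateValue false (false , false , false) = solve 2 (recurrenceEquation false (false , false , false)) refl
glueStep-stateValue true  (true  , true  , true ) = solve 2 (recurrenceEquation true  (true  , true  , true )) refl
glueStep-stateValue true  (true  , true  , false) = solve 2 (recurrenceEquation true  (true  , true  , false)) refl
glueStep-stateValue true  (true  , false , true ) = solve 2 (recurrenceEquation true  (true  , false , true )) refl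
glueStep-stateValue true  (true  , false , false) = solve 2 (recurrenceEquation true  (true  , false , false)) refl
glueStep-stateValue true  (false , true  , true ) = solve 2 (recurrenceEquation true  (false , true  , true )) refl
glueStep-stateValue true  (false , true  , false) = solve 2 (recurrenceEquation true  (false , true  , false)) refl
glueStep-stateValue true  (false , false , true ) = solve 2 (recurrenceEquation true  (false , false , true )) refl
glueStep-stateValue true  (false , false , false) = solve 2 (recurrenceEquation true  (false , false , false)) refl

∑-admissible-stateValue : ∀ isOdd P Q →
  ∑[ t ← cornerStates ] [ admissible isOdd t ]· stateValue isOdd P Q t ≡
  (if isOdd then 3ℚ * P + Q else P + 3ℚ * Q)
∑-admissible-stateValue false =
  solve 2 (λ P Q → Poly.admissibleSum 2 false (Poly.stateValue 2 false P Q) := P :+ con 3ℚ :* Q) refl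
∑-admissible-stateValue true  =
  solve 2 (λ P Q → Poly.admissibleSum 2 true (Poly.stateValue 2 true P Q) := con 3ℚ :* P :+ Q) refl

labelWeightWith : {C : Set} → C → C → C → Label → C
labelWeightWith wa wb wc a = wa
labelWeightWith wa wb wc b = wb
labelWeightWith wa wb wc c = wc

weightWith : {C V : Set} → (C → C → C) → C → (Label → C) → List (V × V × Label) → C
weightWith _⊗_ 1c w = foldr (λ e r → w (proj₂ (proj₂ e)) ⊗ r) 1c

innerDimersWithState : ∀ k → CornerState → List (List (Edge k))
innerDimersWithState k t = filter (λ M → T? (isInnerDimer k M ∧ (t =ˢ cornerState k M))) (subsets (edges k))

baseEquation : CornerState → Polynomial 3 → Polynomial 3 → Polynomial 3 → Polynomial 3 × Polynomial 3
baseEquation t X Y Z =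
  sumWith _:+_ (con 0ℚ) (innerDimersWithState 0 t) (weightWith _:*_ (con 1ℚ) (labelWeightWith X Y Z))
  := Poly.stateValue 3 false (X :* (X :* (X :* con 1ℚ)) :+ Y :* (Y :* (Y :* con 1ℚ))) (X :* Z :+ Y :* Z) t

-- By evaluation over the 2⁹ edge subsets of Γ₂.
∑-innerDimersWithState-zero : ∀ t x y z →
  ∑ (innerDimersWithState 0 t) (weightWith _*_ 1ℚ (weight x y z)) ≡
  stateValue false (x ^ℚ 3 + y ^ℚ 3) (x * z + y * z) t
∑-innerDimersWithState-zero (true  , true  , true ) = solve 3 (baseEquation (true  , true  , true )) refl
∑-innerDimersWithState-zero (true  , true  , false) = solve 3 (baseEquation (true  , true  , false)) refl
∑-innerDimersWithState-zero (true  , false , true ) = solve 3 (baseEquation (true  , false , true )) refl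
∑-innerDimersWithState-zero (true  , false , false) = solve 3 (baseEquation (true  , false , false)) refl
∑-innerDimersWithState-zero (false , true  , true ) = solve 3 (baseEquation (false , true  , true )) refl
∑-innerDimersWithState-zero (false , true  , false) = solve 3 (baseEquation (false , true  , false)) refl
∑-innerDimersWithState-zero (false , false , true ) = solve 3 (baseEquation (false , false , true )) refl
∑-innerDimersWithState-zero (false , false , false) = solve 3 (baseEquation (false , false , false)) refl

module Weighted (x y z : ℚ) where

  weightOf : {V : Set} → List (V × V × Label) → ℚ
  weightOf = weightWith _*_ 1ℚ (weight x y z)

  weightOf-++ : {V : Set} (M N : List (V × V × Label)) → weightOf (M ++ N) ≡ weightOf M * weightOf N
  weightOf-++ []      N = sym (*-identityˡ _)
  weightOf-++ (e ∷ M) N =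
    trans (cong (weight x y z (proj₂ (proj₂ e)) *_) (weightOf-++ M N))
          (sym (*-assoc (weight x y z (proj₂ (proj₂ e))) (weightOf M) (weightOf N)))

  weightOf-map-glueEdge : ∀ k i (S : List (Edge k)) → weightOf (map (glueEdge k i) S) ≡ weightOf S
  weightOf-map-glueEdge k i []      = refl
  weightOf-map-glueEdge k i (e ∷ S) = cong (weight x y z (proj₂ (proj₂ e)) *_) (weightOf-map-glueEdge k i S)

  weightOf-glue : ∀ k S₀ S₁ S₂ → weightOf (glue k S₀ S₁ S₂) ≡ weightOf S₀ * (weightOf S₁ * weightOf S₂)
  weightOf-glue k S₀ S₁ S₂ =
    trans (weightOf-++ (map (glueEdge k copyL) S₀) _)
      (cong₂ _*_ (weightOf-map-glueEdge k copyL S₀)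
        (trans (weightOf-++ (map (glueEdge k copyU) S₁) _)
          (cong₂ _*_ (weightOf-map-glueEdge k copyU S₁) (weightOf-map-glueEdge k copyR S₂))))

  contribution : ∀ k → CornerState → List (Edge k) → ℚ
  contribution k t M = [ isInnerDimer k M ∧ (t =ˢ cornerState k M) ]· weightOf M

  Z : ∀ k → CornerState → ℚ
  Z k t = ∑ (subsets (edges k)) (contribution k t)

  contribution-glue : ∀ k t S₀ S₁ S₂ →
    contribution (suc k) t (glue k S₀ S₁ S₂) ≡
    ∑[ s ← cornerStates ] contribution k (stateL t s) S₀ * (contribution k (stateU t s) S₁ * contribution k (stateR t s) S₂)
  contribution-glue k t S₀ S₁ S₂ = begin
    [ isInnerDimer (suc k) G ∧ (t =ˢ cornerState (suc k) G) ]· weightOf G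
      ≡⟨ cong₂ (λ inner cs → [ inner ∧ (t =ˢ cs) ]· weightOf G) isInnerDimer-glue cornerState-glue ⟩
    [ glued ]· weightOf G
      ≡⟨ cong ([ glued ]·_) (weightOf-glue k S₀ S₁ S₂) ⟩
    [ glued ]· W
      ≡⟨ sym (∑-=ˢ (junctionState c₀ c₁) (λ _ → [ glued ]· W)) ⟩
    ∑[ s ← cornerStates ] [ s =ˢ junctionState c₀ c₁ ]· [ glued ]· W
      ≡⟨ ∑-cong cornerStates (λ s → sym (product s)) ⟩
    ∑[ s ← cornerStates ] contribution k (stateL t s) S₀ * (contribution k (stateU t s) S₁ * contribution k (stateR t s) S₂)
      ∎
    where
    open ≡-Reasoning
    open Glue k S₀ S₁ S₂ using (G; isInnerDimer-glue; cornerState-glue)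
    i₀ i₁ i₂ : Bool
    i₀ = isInnerDimer k S₀
    i₁ = isInnerDimer k S₁
    i₂ = isInnerDimer k S₂
    c₀ c₁ c₂ : CornerState
    c₀ = cornerState k S₀
    c₁ = cornerState k S₁
    c₂ = cornerState k S₂
    glued : Bool
    glued = (i₀ ∧ (i₁ ∧ (i₂ ∧ compatible c₀ c₁ c₂))) ∧ (t =ˢ outerState c₀ c₁ c₂)
    W : ℚ
    W = weightOf S₀ * (weightOf S₁ * weightOf S₂)
    product : ∀ s → contribution k (stateL t s) S₀ * (contribution k (stateU t s) S₁ * contribution k (stateR t s) S₂) ≡
                    [ s =ˢ junctionState c₀ c₁ ]· [ glued ]· W
    product s = begin
      [ i₀ ∧ e₀ ]· weightOf S₀ * ([ i₁ ∧ e₁ ]· weightOf S₁ * [ i₂ ∧ e₂ ]· weightOf S₂)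
        ≡⟨ cong ([ i₀ ∧ e₀ ]· weightOf S₀ *_) ([]·-*-[]· (i₁ ∧ e₁) (i₂ ∧ e₂) (weightOf S₁) (weightOf S₂)) ⟩
      [ i₀ ∧ e₀ ]· weightOf S₀ * [ (i₁ ∧ e₁) ∧ (i₂ ∧ e₂) ]· (weightOf S₁ * weightOf S₂)
        ≡⟨ []·-*-[]· (i₀ ∧ e₀) ((i₁ ∧ e₁) ∧ (i₂ ∧ e₂)) (weightOf S₀) (weightOf S₁ * weightOf S₂) ⟩
      [ (i₀ ∧ e₀) ∧ ((i₁ ∧ e₁) ∧ (i₂ ∧ e₂)) ]· W
        ≡⟨ cong ([_]· W) (∧-regroup i₀ i₁ i₂ e₀ e₁ e₂ (s =ˢ junctionState c₀ c₁) (compatible c₀ c₁ c₂)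
                                   (t =ˢ outerState c₀ c₁ c₂) (copyStates-match t s c₀ c₁ c₂)) ⟩
      [ (s =ˢ junctionState c₀ c₁) ∧ glued ]· W
        ≡⟨ []·-∧ (s =ˢ junctionState c₀ c₁) glued W ⟩
      [ s =ˢ junctionState c₀ c₁ ]· [ glued ]· W
        ∎
      where
      e₀ e₁ e₂ : Bool
      e₀ = stateL t s =ˢ c₀
      e₁ = stateU t s =ˢ c₁
      e₂ = stateR t s =ˢ c₂

  Z-suc : ∀ k t → Z (suc k) t ≡ glueStep (Z k) t
  Z-suc k t = begin
    ∑ (subsets (edges (suc k))) (contribution (suc k) t)
      ≡⟨ ∑-subsets-edges-suc k (contribution (suc k) t) ⟩
    (∑[ S₀ ← Ss ] ∑[ S₁ ← Ss ] ∑[ S₂ ← Ss ] contribution (suc k) t (glue k S₀ S₁ S₂))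
      ≡⟨ ∑-cong Ss (λ S₀ → ∑-cong Ss (λ S₁ → ∑-cong Ss (λ S₂ → contribution-glue k t S₀ S₁ S₂))) ⟩
    (∑[ S₀ ← Ss ] ∑[ S₁ ← Ss ] ∑[ S₂ ← Ss ] ∑[ s ← cornerStates ]
      contribution k (stateL t s) S₀ * (contribution k (stateU t s) S₁ * contribution k (stateR t s) S₂))
      ≡⟨ ∑³-factor Ss Ss Ss cornerStates (λ s → contribution k (stateL t s)) (λ s → contribution k (stateU t s))
                                      (λ s → contribution k (stateR t s)) ⟩
    glueStep (Z k) t
      ∎
    where
    open ≡-Reasoning
    Ss : List (List (Edge k))
    Ss = subsets (edges k)

  Φ′-Z : ∀ k → Φ′ k x y z ≡ ∑[ t ← cornerStates ] [ admissible (odd k) t ]· Z k t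
  Φ′-Z k = begin
    foldr _+_ 0ℚ (map weightOf (filter (λ M → T? (isDimer k M)) Ss))
      ≡⟨ foldr-+-map weightOf (filter (λ M → T? (isDimer k M)) Ss) ⟩
    ∑ (filter (λ M → T? (isDimer k M)) Ss) weightOf
      ≡⟨ ∑-filter (isDimer k) Ss weightOf ⟩
    ∑[ M ← Ss ] [ isDimer k M ]· weightOf M
      ≡⟨ ∑-cong Ss (λ M → trans (cong ([_]· weightOf M) (isDimer-inner k M)) (resolve M)) ⟩
    ∑[ M ← Ss ] ∑[ t ← cornerStates ] [ admissible (odd k) t ]· contribution k t M
      ≡⟨ ∑-comm Ss cornerStates (λ M t → [ admissible (odd k) t ]· contribution k t M) ⟩
    ∑[ t ← cornerStates ] ∑[ M ← Ss ] [ admissible (odd k) t ]· contribution k t M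
      ≡⟨ ∑-cong cornerStates (λ t → ∑-[]· (admissible (odd k) t) Ss (contribution k t)) ⟩
    ∑[ t ← cornerStates ] [ admissible (odd k) t ]· Z k t
      ∎
    where
    open ≡-Reasoning
    Ss : List (List (Edge k))
    Ss = subsets (edges k)
    resolve : ∀ M → [ isInnerDimer k M ∧ admissible (odd k) (cornerState k M) ]· weightOf M ≡
                    ∑[ t ← cornerStates ] [ admissible (odd k) t ]· contribution k t M
    resolve M = sym (begin
      ∑[ t ← cornerStates ] [ ok t ]· [ inner ∧ (t =ˢ cs) ]· w
        ≡⟨ ∑-cong cornerStates (λ t → trans (cong ([ ok t ]·_) ([]·-∧ inner (t =ˢ cs) w))
                                            ([]·-comm (ok t) inner ([ t =ˢ cs ]· w))) ⟩
      ∑[ t ← cornerStates ] [ inner ]· [ ok t ]· [ t =ˢ cs ]· w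
        ≡⟨ ∑-cong cornerStates (λ t → trans (cong ([ inner ]·_) ([]·-comm (ok t) (t =ˢ cs) w))
                                            ([]·-comm inner (t =ˢ cs) ([ ok t ]· w))) ⟩
      ∑[ t ← cornerStates ] [ t =ˢ cs ]· [ inner ]· [ ok t ]· w
        ≡⟨ ∑-=ˢ cs (λ t → [ inner ]· [ ok t ]· w) ⟩
      [ inner ]· [ ok cs ]· w
        ≡⟨ sym ([]·-∧ inner (ok cs) w) ⟩
      [ inner ∧ ok cs ]· w
        ∎)
      where
      ok : CornerState → Bool
      ok = admissible (odd k)
      inner : Bool
      inner = isInnerDimer k M
      cs : CornerState
      cs = cornerState k M
      w : ℚ
      w = weightOf M

  Z-zero : ∀ t → Z 0 t ≡ stateValue false (x ^ℚ 3 + y ^ℚ 3) (x * z + y * z) t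
  Z-zero t = trans (sym (∑-filter (λ M → isInnerDimer 0 M ∧ (t =ˢ cornerState 0 M)) (subsets (edges 0)) weightOf))
                   (∑-innerDimersWithState-zero t x y z)

  P Q : ℕ → ℚ
  P zero    = x ^ℚ 3 + y ^ℚ 3
  P (suc k) = nextP (odd k) (P k) (Q k)
  Q zero    = x * z + y * z
  Q (suc k) = nextQ (odd k) (P k) (Q k)

  Z-stateValue : ∀ k t → Z k t ≡ stateValue (odd k) (P k) (Q k) t
  Z-stateValue zero    t = Z-zero t
  Z-stateValue (suc k) t =
    trans (Z-suc k t)
      (trans (∑-cong cornerStates (λ s → cong₂ _*_ (Z-stateValue k (stateL t s))
                                        (cong₂ _*_ (Z-stateValue k (stateU t s)) (Z-stateValue k (stateR t s)))))
             (glueStep-stateValue (odd k) t (P k) (Q k)))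

  Φ′-PQ : ∀ k → Φ′ k x y z ≡ (if odd k then 3ℚ * P k + Q k else P k + 3ℚ * Q k)
  Φ′-PQ k = trans (Φ′-Z k) (trans (∑-cong cornerStates (λ t → cong ([ admissible (odd k) t ]·_) (Z-stateValue k t)))
                                  (∑-admissible-stateValue (odd k) (P k) (Q k)))

-- Closed form

^-+ : ∀ v m n → v ^ℚ (m ℕ.+ n) ≡ v ^ℚ m * v ^ℚ n
^-+ v zero    n = sym (*-identityˡ _)
^-+ v (suc m) n = trans (cong (v *_) (^-+ v m n)) (sym (*-assoc v (v ^ℚ m) (v ^ℚ n)))

^-3* : ∀ v m → v ^ℚ (3 ℕ.* m) ≡ v ^ℚ m * (v ^ℚ m * v ^ℚ m)
^-3* v m = trans (^-+ v m _) (cong (v ^ℚ m *_) (trans (^-+ v m _) (cong (λ e → v ^ℚ m * v ^ℚ e) (ℕₚ.+-identityʳ m))))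

exp2 expP expQ : ℕ → ℕ
exp2 zero    = 0
exp2 (suc k) = suc (3 ℕ.* exp2 k)
expP zero    = 0
expP (suc k) = if odd k then 2 ℕ.+ 3 ℕ.* expP k else 3 ℕ.* expP k
expQ zero    = 0
expQ (suc k) = if odd k then 3 ℕ.* expQ k else 2 ℕ.+ 3 ℕ.* expQ k

exp2-spec : ∀ k → exp2 k ℕ.* 2 ℕ.+ 1 ≡ 3 ^ℕ k
exp2-spec zero    = refl
exp2-spec (suc k) = trans (triple-shift (exp2 k)) (cong (3 ℕ.*_) (exp2-spec k))
  where
  triple-shift : ∀ m → suc (3 ℕ.* m) ℕ.* 2 ℕ.+ 1 ≡ 3 ℕ.* (m ℕ.* 2 ℕ.+ 1)
  triple-shift = solve-∀

ExponentSpec : Bool → ℕ → ℕ → ℕ → Set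
ExponentSpec false β γ k = (β ℕ.* 4 ℕ.+ 1 ≡ 3 ^ℕ k) × (γ ℕ.* 4 ℕ.+ 3 ≡ 3 ^ℕ suc k)
ExponentSpec true  β γ k = (β ℕ.* 4 ℕ.+ 3 ≡ 3 ^ℕ k) × (γ ℕ.* 4 ℕ.+ 1 ≡ 3 ^ℕ suc k)

expP-expQ-spec : ∀ k → ExponentSpec (odd k) (expP k) (expQ k) k
expP-expQ-spec zero    = refl , refl
expP-expQ-spec (suc k) = step (odd k) (expP k) (expQ k) (expP-expQ-spec k)
  where
  shift₁ : ∀ m → 3 ℕ.* m ℕ.* 4 ℕ.+ 3 ≡ 3 ℕ.* (m ℕ.* 4 ℕ.+ 1)
  shift₁ = solve-∀
  shift₃ : ∀ m → (2 ℕ.+ 3 ℕ.* m) ℕ.* 4 ℕ.+ 1 ≡ 3 ℕ.* (m ℕ.* 4 ℕ.+ 3)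
  shift₃ = solve-∀
  step : ∀ b β γ → ExponentSpec b β γ k →
         ExponentSpec (not b) (if b then 2 ℕ.+ 3 ℕ.* β else 3 ℕ.* β) (if b then 3 ℕ.* γ else 2 ℕ.+ 3 ℕ.* γ) (suc k)
  step false β γ (eβ , eγ) = trans (shift₁ β) (cong (3 ℕ.*_) eβ) , trans (shift₃ γ) (cong (3 ℕ.*_) eγ)
  step true  β γ (eβ , eγ) = trans (shift₃ β) (cong (3 ℕ.*_) eβ) , trans (shift₁ γ) (cong (3 ℕ.*_) eγ)

/-exact : ∀ m d r .{{_ : ℕ.NonZero d}} {n} → m ℕ.* d ℕ.+ r ≡ n → (n ∸ r) / d ≡ m
/-exact m d r refl = trans (cong (_/ d) (ℕₚ.m+n∸n≡m (m ℕ.* d) r)) (m*n/n≡m m d)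

module ClosedForm (x y z : ℚ) where
  open Weighted x y z

  p q : ℚ
  p = x ^ℚ 3 + y ^ℚ 3
  q = x * z + y * z

  closed : ℕ → ℕ → ℕ → ℚ
  closed α β γ = 2ℚ ^ℚ α * p ^ℚ β * q ^ℚ γ

  closed-sucβ : ∀ α β γ → closed α (suc β) γ ≡ p * closed α β γ
  closed-sucβ α β γ = regroup (2ℚ ^ℚ α) (p ^ℚ β) (q ^ℚ γ) p
    where
    regroup : ∀ t u w p → t * (p * u) * w ≡ p * (t * u * w)
    regroup = solve 4 (λ t u w p → t :* (p :* u) :* w := p :* (t :* u :* w)) refl

  closed-sucγ : ∀ α β γ → closed α β (suc γ) ≡ q * closed α β γ
  closed-sucγ α β γ = regroup (2ℚ ^ℚ α) (p ^ℚ β) (q ^ℚ γ) q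
    where
    regroup : ∀ t u w q → t * u * (q * w) ≡ q * (t * u * w)
    regroup = solve 4 (λ t u w q → t :* u :* (q :* w) := q :* (t :* u :* w)) refl

  closed-3* : ∀ α β γ i j → closed (suc (3 ℕ.* α)) (i ℕ.+ 3 ℕ.* β) (j ℕ.+ 3 ℕ.* γ) ≡
                            2ℚ * (p ^ℚ i * (q ^ℚ j * (closed α β γ * (closed α β γ * closed α β γ))))
  closed-3* α β γ i j = begin
    2ℚ * 2ℚ ^ℚ (3 ℕ.* α) * p ^ℚ (i ℕ.+ 3 ℕ.* β) * q ^ℚ (j ℕ.+ 3 ℕ.* γ)
      ≡⟨ cong₂ _*_ (cong₂ _*_ (cong (2ℚ *_) (^-3* 2ℚ α)) (trans (^-+ p i _) (cong (p ^ℚ i *_) (^-3* p β))))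
                   (trans (^-+ q j _) (cong (q ^ℚ j *_) (^-3* q γ))) ⟩
    2ℚ * (t * (t * t)) * (p ^ℚ i * (u * (u * u))) * (q ^ℚ j * (w * (w * w)))
      ≡⟨ regroup t u w (p ^ℚ i) (q ^ℚ j) ⟩
    2ℚ * (p ^ℚ i * (q ^ℚ j * (t * u * w * (t * u * w * (t * u * w)))))
      ∎
    where
    open ≡-Reasoning
    t u w : ℚ
    t = 2ℚ ^ℚ α
    u = p ^ℚ β
    w = q ^ℚ γ
    regroup : ∀ t u w i j → 2ℚ * (t * (t * t)) * (i * (u * (u * u))) * (j * (w * (w * w))) ≡
                            2ℚ * (i * (j * (t * u * w * (t * u * w * (t * u * w)))))
    regroup = solve 5 (λ t u w i j → con 2ℚ :* (t :* (t :* t)) :* (i :* (u :* (u :* u))) :* (j :* (w :* (w :* w))) :=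
                                     con 2ℚ :* (i :* (j :* (t :* u :* w :* (t :* u :* w :* (t :* u :* w)))))) refl

  closed-nextP-nextQ : ∀ isOdd α β γ →
    let β′ = if isOdd then 2 ℕ.+ 3 ℕ.* β else 3 ℕ.* β
        γ′ = if isOdd then 3 ℕ.* γ else 2 ℕ.+ 3 ℕ.* γ
    in (nextP isOdd (closed α (suc β) γ) (closed α β (suc γ)) ≡ closed (suc (3 ℕ.* α)) (suc β′) γ′)
     × (nextQ isOdd (closed α (suc β) γ) (closed α β (suc γ)) ≡ closed (suc (3 ℕ.* α)) β′ (suc γ′))
  closed-nextP-nextQ false α β γ =
    trans (cong₂ (nextP false) (closed-sucβ α β γ) (closed-sucγ α β γ))
          (trans (regroupP p q (closed α β γ)) (sym (closed-3* α β γ 1 2))) ,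
    trans (cong₂ (nextQ false) (closed-sucβ α β γ) (closed-sucγ α β γ))
          (trans (regroupQ p q (closed α β γ)) (sym (closed-3* α β γ 0 3)))
    where
    regroupP : ∀ p q r → 2ℚ * (p * r * (q * r * (q * r))) ≡ 2ℚ * (p * 1ℚ * (q * (q * 1ℚ) * (r * (r * r))))
    regroupP = solve 3 (λ p q r → con 2ℚ :* (p :* r :* (q :* r :* (q :* r))) :=
                                  con 2ℚ :* (p :* con 1ℚ :* (q :* (q :* con 1ℚ) :* (r :* (r :* r))))) refl
    regroupQ : ∀ p q r → 2ℚ * (q * r * (q * r * (q * r))) ≡ 2ℚ * (1ℚ * (q * (q * (q * 1ℚ)) * (r * (r * r))))
    regroupQ = solve 3 (λ p q r → con 2ℚ :* (q :* r :* (q :* r :* (q :* r))) :=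
                                  con 2ℚ :* (con 1ℚ :* (q :* (q :* (q :* con 1ℚ)) :* (r :* (r :* r))))) refl
  closed-nextP-nextQ true α β γ =
    trans (cong₂ (nextP true) (closed-sucβ α β γ) (closed-sucγ α β γ))
          (trans (regroupP p q (closed α β γ)) (sym (closed-3* α β γ 3 0))) ,
    trans (cong₂ (nextQ true) (closed-sucβ α β γ) (closed-sucγ α β γ))
          (trans (regroupQ p q (closed α β γ)) (sym (closed-3* α β γ 2 1)))
    where
    regroupP : ∀ p q r → 2ℚ * (p * r * (p * r * (p * r))) ≡ 2ℚ * (p * (p * (p * 1ℚ)) * (1ℚ * (r * (r * r))))
    regroupP = solve 3 (λ p q r → con 2ℚ :* (p :* r :* (p :* r :* (p :* r))) :=
                                  con 2ℚ :* (p :* (p :* (p :* con 1ℚ)) :* (con 1ℚ :* (r :* (r :* r))))) refl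
    regroupQ : ∀ p q r → 2ℚ * (p * r * (p * r * (q * r))) ≡ 2ℚ * (p * (p * 1ℚ) * (q * 1ℚ * (r * (r * r))))
    regroupQ = solve 3 (λ p q r → con 2ℚ :* (p :* r :* (p :* r :* (q :* r))) :=
                                  con 2ℚ :* (p :* (p :* con 1ℚ) :* (q :* con 1ℚ :* (r :* (r :* r))))) refl

  PQ-closed : ∀ k → (P k ≡ closed (exp2 k) (suc (expP k)) (expQ k)) × (Q k ≡ closed (exp2 k) (expP k) (suc (expQ k)))
  PQ-closed zero    = unitP p , unitQ q
    where
    unitP : ∀ r → r ≡ 1ℚ * (r * 1ℚ) * 1ℚ
    unitP = solve 1 (λ r → r := con 1ℚ :* (r :* con 1ℚ) :* con 1ℚ) refl
    unitQ : ∀ r → r ≡ 1ℚ * 1ℚ * (r * 1ℚ)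
    unitQ = solve 1 (λ r → r := con 1ℚ :* con 1ℚ :* (r :* con 1ℚ)) refl
  PQ-closed (suc k) =
    trans (cong₂ (nextP (odd k)) (proj₁ (PQ-closed k)) (proj₂ (PQ-closed k)))
          (proj₁ (closed-nextP-nextQ (odd k) (exp2 k) (expP k) (expQ k))) ,
    trans (cong₂ (nextQ (odd k)) (proj₁ (PQ-closed k)) (proj₂ (PQ-closed k)))
          (proj₂ (closed-nextP-nextQ (odd k) (exp2 k) (expP k) (expQ k)))

  partitionFactor : Bool → ℚ
  partitionFactor false = x ^ℚ 3 + y ^ℚ 3 + 3ℚ * z * (x + y)
  partitionFactor true  = 3ℚ * (x ^ℚ 3 + y ^ℚ 3) + z * (x + y)

  Φ′-closed : ∀ k → Φ′ k x y z ≡ closed (exp2 k) (expP k) (expQ k) * partitionFactor (odd k)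
  Φ′-closed k = trans (Φ′-PQ k) (factor (odd k))
    where
    C : ℚ
    C = closed (exp2 k) (expP k) (expQ k)
    P≡ : P k ≡ p * C
    P≡ = trans (proj₁ (PQ-closed k)) (closed-sucβ (exp2 k) (expP k) (expQ k))
    Q≡ : Q k ≡ q * C
    Q≡ = trans (proj₂ (PQ-closed k)) (closed-sucγ (exp2 k) (expP k) (expQ k))
    factor : ∀ b → (if b then 3ℚ * P k + Q k else P k + 3ℚ * Q k) ≡ C * partitionFactor b
    factor false = trans (cong₂ (λ P Q → P + 3ℚ * Q) P≡ Q≡) (regroup (x ^ℚ 3) (y ^ℚ 3) x y z C)
      where
      regroup : ∀ a b x y z r → (a + b) * r + 3ℚ * ((x * z + y * z) * r) ≡ r * (a + b + 3ℚ * z * (x + y))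
      regroup = solve 6 (λ a b x y z r → (a :+ b) :* r :+ con 3ℚ :* ((x :* z :+ y :* z) :* r) :=
                                         r :* (a :+ b :+ con 3ℚ :* z :* (x :+ y))) refl
    factor true  = trans (cong₂ (λ P Q → 3ℚ * P + Q) P≡ Q≡) (regroup (x ^ℚ 3) (y ^ℚ 3) x y z C)
      where
      regroup : ∀ a b x y z r → 3ℚ * ((a + b) * r) + (x * z + y * z) * r ≡ r * (3ℚ * (a + b) + z * (x + y))
      regroup = solve 6 (λ a b x y z r → con 3ℚ :* ((a :+ b) :* r) :+ (x :* z :+ y :* z) :* r :=
                                         r :* (con 3ℚ :* (a :+ b) :+ z :* (x :+ y))) refl

  Φ′-even : ∀ k → odd k ≡ false →
    Φ′ k x y z ≡ closed ((3 ^ℕ k ∸ 1) / 2) ((3 ^ℕ k ∸ 1) / 4) ((3 ^ℕ suc k ∸ 3) / 4) * partitionFactor false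
  Φ′-even k even with odd k | expP-expQ-spec k | Φ′-closed k
  Φ′-even k refl | false | eβ , eγ | Φ′≡
    rewrite /-exact (exp2 k) 2 1 (exp2-spec k) | /-exact (expP k) 4 1 eβ | /-exact (expQ k) 4 3 eγ = Φ′≡

  Φ′-odd : ∀ k → odd k ≡ true →
    Φ′ k x y z ≡ closed ((3 ^ℕ k ∸ 1) / 2) ((3 ^ℕ k ∸ 3) / 4) ((3 ^ℕ suc k ∸ 1) / 4) * partitionFactor true
  Φ′-odd k isOdd with odd k | expP-expQ-spec k | Φ′-closed k
  Φ′-odd k refl | true | eβ , eγ | Φ′≡
    rewrite /-exact (exp2 k) 2 1 (exp2-spec k) | /-exact (expP k) 4 3 eβ | /-exact (expQ k) 4 1 eγ = Φ′≡

theorem4p3 : (n : ℕ) → 2 ≤ n → (x y z : ℚ) → Positive x → Positive y → Positive z →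
    (n % 2 ≡ 0 →
      Φ n x y z ≡
        ((2ℚ ^ℚ (((3 ^ℕ (n ∸ 2)) ∸ 1) / 2))
        * ((x ^ℚ 3 + y ^ℚ 3) ^ℚ (((3 ^ℕ (n ∸ 2)) ∸ 1) / 4))
        * ((x * z + y * z) ^ℚ (((3 ^ℕ (n ∸ 1)) ∸ 3) / 4))
        * (x ^ℚ 3 + y ^ℚ 3 + 3ℚ * z * (x + y))))
    × (n % 2 ≡ 1 →
      Φ n x y z ≡
        ((2ℚ ^ℚ (((3 ^ℕ (n ∸ 2)) ∸ 1) / 2))
        * ((x ^ℚ 3 + y ^ℚ 3) ^ℚ (((3 ^ℕ (n ∸ 2)) ∸ 3) / 4))
        * ((x * z + y * z) ^ℚ (((3 ^ℕ (n ∸ 1)) ∸ 1) / 4))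
        * (3ℚ * (x ^ℚ 3 + y ^ℚ 3) + z * (x + y))))
-- The identity is polynomial.
theorem4p3 (suc (suc k)) (s≤s (s≤s z≤n)) x y z _ _ _ =
  (λ n%2≡0 → Φ′-even k (odd-from-%2 k n%2≡0)) , (λ n%2≡1 → Φ′-odd k (odd-from-%2 k n%2≡1))
  where open ClosedForm x y z
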